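{- Let $d$ be a nonnegative integer and $\rho:=p^{ -d}$. Let $A\subset\mathbb{F}_p^n$ have density $\alpha$, and let $\Phi=\{(x,y)\in A\times\mathbb{F}_p^n:y\in u+V_x\}$, where $u\in\mathbb{F}_p^n$ and each $V_x$ is a subspace of $\mathbb{F}_p^n$ of codimension $d$. Then for every natural number $s$, \[ \|A-\alpha\|_{U^s(\mathbb{F}_p^n)}\leq\frac{1}{\rho}\|\Phi-\alpha\rho\|_{U^s(\mathbb{F}_p^n\times\mathbb{F}_p^n)}. \]
   Context: $p$ is a prime. Sets are identified with indicator functions; density of $A$ is $|A|/p^n$. For an abelian group $H$ and $f:H\to\mathbb{C}$, $\|f\|_{U^s(H)}:=(\mathbb{E}_{x,h_1,\dots,h_s\in H}\Delta_{h_1,\dots,h_s}f(x))^{1/2^s}$ where $\Delta_hf(x)=f(x)\overline{f(x+h)}$ and $\Delta_{h_1,\dots,h_s}=\Delta_{h_1}\cdots\Delta_{h_s}$; $A-\alpha$ and $\Phi-\alpha\rho$ are the functions $x\mapsto A(x)-\alpha$ on $\mathbb{F}_p^n$ and $(x,y)\mapsto\Phi(x,y)-\alpha\rho$ on $\mathbb{F}_p^n\times\mathbb{F}_p^n$. -}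

module Defs where

open import Data.Nat as ℕ using (ℕ; zero; suc; NonZero; _∸_)
open import Data.Nat.Properties using (m^n≢0)
open import Data.Nat.DivMod using (_mod_)
open import Data.Fin as Fin using (Fin; toℕ)
open import Data.Vec as Vec using (Vec; []; _∷_; replicate; zipWith; foldr)
open import Data.List as List using (List; []; _∷_; length; concatMap; map; allFin; cartesianProductWith)
open import Data.Bool using (Bool; true; false; if_then_else_)
open import Data.Integer using (+_)
open import Data.Rational using (ℚ; 0ℚ; 1ℚ; _+_; _*_; _-_; _/_)
open import Data.Product using (Σ; _×_; _,_; proj₁; proj₂)
open import Relation.Binary.PropositionalEquality using (_≡_)
open import Function.Bundles using (_⇔_)

-- The field F_p (p with NonZero instance; primality is a separate
-- hypothesis of the theorem) and the vector space F_p^n.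

module _ (p : ℕ) .{{_ : NonZero p}} where

  Fp : Set
  Fp = Fin p

  _+p_ : Fp → Fp → Fp
  a +p b = (toℕ a ℕ.+ toℕ b) mod p

  _*p_ : Fp → Fp → Fp
  a *p b = (toℕ a ℕ.* toℕ b) mod p

  negp : Fp → Fp
  negp a = (p ∸ toℕ a) mod p

  0p : Fp
  0p = 0 mod p

  Vn : ℕ → Set
  Vn n = Vec Fp n

  _+v_ : ∀ {n} → Vn n → Vn n → Vn n
  _+v_ = zipWith _+p_

  _-v_ : ∀ {n} → Vn n → Vn n → Vn n
  u -v v = zipWith (λ a b → a +p negp b) u v

  _·v_ : ∀ {n} → Fp → Vn n → Vn n
  c ·v v = Vec.map (c *p_) v

  0v : ∀ {n} → Vn n
  0v = replicate _ 0p

  allVn : ∀ n → List (Vn n)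
  allVn zero    = [] ∷ []
  allVn (suc n) = concatMap (λ a → map (a ∷_) (allVn n)) (allFin p)

  lincomb : ∀ {n k} → Vec Fp k → Vec (Vn n) k → Vn n
  lincomb cs bs = foldr _ _+v_ 0v (zipWith _·v_ cs bs)

  LinIndep : ∀ {n k} → Vec (Vn n) k → Set
  LinIndep bs = ∀ cs → lincomb cs bs ≡ 0v → cs ≡ replicate _ 0p

  IsSubspaceOfDim : ∀ {n} → (Vn n → Bool) → ℕ → Set
  IsSubspaceOfDim {n} V k =
    Σ (Vec (Vn n) k) λ bs → LinIndep bs ×
      (∀ y → (V y ≡ true) ⇔ Σ (Vec Fp k) (λ cs → lincomb cs bs ≡ y))

  IsSubspaceOfCodim : ∀ {n} → (Vn n → Bool) → ℕ → Set
  IsSubspaceOfCodim {n} V d = (d ℕ.≤ n) × IsSubspaceOfDim V (n ∸ d)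

record FinGroup : Set₁ where
  field
    Carrier : Set
    elems   : List Carrier
    _⊕_     : Carrier → Carrier → Carrier

indQ : Bool → ℚ
indQ true  = 1ℚ
indQ false = 0ℚ

sumQ : ∀ {X : Set} → List X → (X → ℚ) → ℚ
sumQ []       f = 0ℚ
sumQ (x ∷ xs) f = f x + sumQ xs f

avg : ∀ {X : Set} → List X → (X → ℚ) → ℚ
avg []           f = 0ℚ
avg xs@(_ ∷ ys)  f = sumQ xs f * ((+ 1) / suc (length ys))

powQ : ℚ → ℕ → ℚ
powQ q zero    = 1ℚ
powQ q (suc k) = q * powQ q k

module _ (H : FinGroup) where
  open FinGroup H

  tuples : ∀ s → List (Vec Carrier s)
  tuples zero    = [] ∷ []
  tuples (suc s) = concatMap (λ h → map (h ∷_) (tuples s)) elems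

  -- Δ_h f (x) = f(x) * conj(f(x+h)); functions are ℚ-valued, so conj = id
  Δ : Carrier → (Carrier → ℚ) → (Carrier → ℚ)
  Δ h f x = f x * f (x ⊕ h)

  Δs : ∀ {s} → Vec Carrier s → (Carrier → ℚ) → (Carrier → ℚ)
  Δs []       f = f
  Δs (h ∷ hs) f = Δ h (Δs hs f)

  -- ‖f‖_{U^s(H)}^{2^s} = E_{x,h_1..h_s ∈ H} Δ_{h_1..h_s} f(x)
  gowersPow : ℕ → (Carrier → ℚ) → ℚ
  gowersPow s f = avg elems (λ x → avg (tuples s) (λ hs → Δs hs f x))

module _ (p : ℕ) .{{_ : NonZero p}} where

  VecGroup : ℕ → FinGroup
  VecGroup n = record { Carrier = Vn p n ; elems = allVn p n ; _⊕_ = _+v_ p }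

  PairGroup : ℕ → FinGroup
  PairGroup n = record
    { Carrier = Vn p n × Vn p n
    ; elems   = cartesianProductWith _,_ (allVn p n) (allVn p n)
    ; _⊕_     = λ a b → (_+v_ p (proj₁ a) (proj₁ b) , _+v_ p (proj₂ a) (proj₂ b))
    }

  density : ∀ {n} → (Vn p n → Bool) → ℚ
  density {n} A = avg (allVn p n) (λ x → indQ (A x))

  rho : ℕ → ℚ
  rho d = (+ 1) / (p ℕ.^ d) where instance _ = m^n≢0 p d

  Phi : ∀ {n} → (Vn p n → Bool) → Vn p n → (Vn p n → Vn p n → Bool)
      → Vn p n × Vn p n → Bool
  Phi A u V (x , y) = if A x then V x (_-v_ p y u) else false

{-# OPTIONS --safe #-}
-- Let K = {0} × Fp^n. Averaging Φ − αρ over the translates by K gives (x , y) ↦ ρ (A(x) − α),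
-- because every coset u + V_x has density ρ; and ‖ρ (A − α) ∘ proj₁‖^(2^s) = ρ^(2^s) ‖A − α‖^(2^s).
-- So it suffices that averaging over translates does not increase ‖·‖^(2^s): by multilinearity,
-- the Gowers inner product of the averaged function is an average of Gowers inner products of
-- 2^s translates of Φ − αρ, each at most ‖Φ − αρ‖^(2^s) by the Gowers–Cauchy–Schwarz inequality.
-- The latter is proved without square roots, collapsing one coordinate of the cube at a time.
module Submission where

open import Defs
open import Data.Bool using (Bool; true; false; _∧_; if_then_else_)
import Data.Bool.Properties as Boolₚ
open import Data.Empty using (⊥-elim)
open import Data.Fin as Fin using (Fin; toℕ)
import Data.Fin.Properties as Finₚ
open import Data.Integer as ℤ using (ℤ; +_)
import Data.Integer.Properties as ℤₚ
open import Data.Integer.Divisibility.Signed using (_∣_; divides; ∣⇒∣ᵤ; ∣m∣n⇒∣m+n; ∣m⇒∣-m; ∣n⇒∣m*n; ∣m⇒∣m*n)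
open import Data.Integer.Tactic.RingSolver using (solve-∀)
open import Data.List as List using (List; []; _∷_; _++_; map; concatMap; length; allFin; cartesianProductWith)
import Data.List.Properties as Listₚ
open import Data.List.Membership.Propositional using (_∈_)
open import Data.List.Membership.Propositional.Properties using (∈-++⁺ˡ; ∈-++⁺ʳ; ∈-map⁺)
open import Data.List.Relation.Unary.Any using (here; there)
open import Data.Nat as ℕ using (ℕ; zero; suc; NonZero; _%_; _^_)
import Data.Nat.Divisibility as ℕ∣
open import Data.Nat.DivMod using (_mod_; m≡m%n+[m/n]*n; m%n<n)
open import Data.Nat.Primality using (Prime)
import Data.Nat.Properties as ℕₚ
open import Data.Nat.Tactic.RingSolver using () renaming (solve to ℕsolve)
open import Data.Product using (∃; _×_; _,_; proj₁; proj₂)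
open import Data.Rational using (ℚ; 0ℚ; 1ℚ; _≤_; _<_; _+_; _*_; _-_; -_; _/_; toℚᵘ; nonNegative; nonPositive; positive)
open import Data.Rational.Properties
open import Data.Rational.Solver using (module +-*-Solver)
import Data.Rational.Unnormalised as ℚᵘ
import Data.Rational.Unnormalised.Properties as ℚᵘₚ
open import Data.Sum using (_⊎_; inj₁; inj₂)
open import Data.Vec as Vec using (Vec; []; _∷_; _[_]≔_; replicate)
import Data.Vec.Properties as Vecₚ
open import Function using (_∘_; id)
open import Function.Bundles using (_⇔_; mk⇔; Equivalence)
open import Relation.Binary.Definitions using (DecidableEquality; tri<; tri≈; tri>)
open import Relation.Binary.PropositionalEquality
open import Relation.Nullary using (yes; no; does)
open import Relation.Nullary.Decidable using (dec-true; dec-false; does-⇔)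

private variable X Y Z : Set

fromℕ : ℕ → ℚ
fromℕ n = + n / 1

-- 1/n, with the junk value 0 at n = 0, as in the normalising factor of avg.
invℕ : ℕ → ℚ
invℕ zero    = 0ℚ
invℕ (suc n) = + 1 / suc n

private
  toℚᵘ-/ : ∀ a b → toℚᵘ (+ a / suc b) ℚᵘ.≃ ℚᵘ.mkℚᵘ (+ a) b
  toℚᵘ-/ a b = toℚᵘ-fromℚᵘ (ℚᵘ.mkℚᵘ (+ a) b)

  fromℕ*invℕ-suc : ∀ m → fromℕ (suc m) * invℕ (suc m) ≡ 1ℚ
  fromℕ*invℕ-suc m = toℚᵘ-injective (ℚᵘₚ.≃-trans (toℚᵘ-homo-* (fromℕ (suc m)) (invℕ (suc m)))
    (ℚᵘₚ.≃-trans (ℚᵘₚ.*-cong (toℚᵘ-/ (suc m) 0) (toℚᵘ-/ 1 m))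
      (ℚᵘ.*≡* (cong (λ k → + suc k) (ℕsolve (m List.∷ List.[]))))))

  invℕ-suc-* : ∀ m n → invℕ (suc m ℕ.* suc n) ≡ invℕ (suc m) * invℕ (suc n)
  invℕ-suc-* m n = toℚᵘ-injective (ℚᵘₚ.≃-trans (toℚᵘ-/ 1 (n ℕ.+ m ℕ.* suc n))
    (ℚᵘₚ.≃-sym (ℚᵘₚ.≃-trans (toℚᵘ-homo-* (invℕ (suc m)) (invℕ (suc n)))
      (ℚᵘₚ.≃-trans (ℚᵘₚ.*-cong (toℚᵘ-/ 1 m) (toℚᵘ-/ 1 n)) (ℚᵘ.*≡* refl)))))

fromℕ-suc : ∀ m → fromℕ (suc m) ≡ 1ℚ + fromℕ m
fromℕ-suc m = toℚᵘ-injective (ℚᵘₚ.≃-trans (toℚᵘ-/ (suc m) 0)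
  (ℚᵘₚ.≃-sym (ℚᵘₚ.≃-trans (toℚᵘ-homo-+ 1ℚ (fromℕ m))
    (ℚᵘₚ.≃-trans (ℚᵘₚ.+-cong (ℚᵘₚ.≃-refl {ℚᵘ.mkℚᵘ (+ 1) 0}) (toℚᵘ-/ m 0)) (ℚᵘ.*≡* (eq (+ m)))))))
  where
  eq : ∀ k → (+ 1 ℤ.* + 1 ℤ.+ k ℤ.* + 1) ℤ.* + 1 ≡ (+ 1 ℤ.+ k) ℤ.* (+ 1 ℤ.* + 1)
  eq = solve-∀

fromℕ*invℕ : ∀ n .{{_ : NonZero n}} → fromℕ n * invℕ n ≡ 1ℚ
fromℕ*invℕ (suc m) = fromℕ*invℕ-suc m

invℕ-* : ∀ m n → invℕ (m ℕ.* n) ≡ invℕ m * invℕ n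
invℕ-* zero    n       = sym (*-zeroˡ (invℕ n))
invℕ-* (suc m) zero    = trans (cong invℕ (ℕₚ.*-zeroʳ m)) (sym (*-zeroʳ (invℕ (suc m))))
invℕ-* (suc m) (suc n) = invℕ-suc-* m n

invℕ≡1/ : ∀ m .{{_ : NonZero m}} → invℕ m ≡ + 1 / m
invℕ≡1/ (suc m) = refl

fromℕ-nonNeg : ∀ n → 0ℚ ≤ fromℕ n
fromℕ-nonNeg n = nonNegative⁻¹ _ {{normalize-nonNeg n 1}}

invℕ-nonNeg : ∀ n → 0ℚ ≤ invℕ n
invℕ-nonNeg zero    = ≤-refl
invℕ-nonNeg (suc n) = nonNegative⁻¹ _ {{normalize-nonNeg 1 (suc n)}}

module _ where
  open ≤-Reasoning

  *-nonNeg : ∀ {a b} → 0ℚ ≤ a → 0ℚ ≤ b → 0ℚ ≤ a * b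
  *-nonNeg {a} {b} 0≤a 0≤b = nonNegative⁻¹ (a * b)
    {{nonNeg*nonNeg⇒nonNeg a {{nonNegative 0≤a}} b {{nonNegative 0≤b}}}}

  *-mono-≤-nonNeg : ∀ {a b c d} → 0ℚ ≤ a → 0ℚ ≤ c → a ≤ b → c ≤ d → a * c ≤ b * d
  *-mono-≤-nonNeg {a} {b} {c} {d} 0≤a 0≤c a≤b c≤d = begin
    a * c ≤⟨ *-monoʳ-≤-nonNeg c {{nonNegative 0≤c}} a≤b ⟩
    b * c ≤⟨ *-monoˡ-≤-nonNeg b {{nonNegative (≤-trans 0≤a a≤b)}} c≤d ⟩
    b * d ∎

  x*x-nonNeg : ∀ x → 0ℚ ≤ x * x
  x*x-nonNeg x with ≤-total 0ℚ x
  ... | inj₁ 0≤x = *-nonNeg 0≤x 0≤x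
  ... | inj₂ x≤0 = nonNegative⁻¹ (x * x)
    {{nonPos*nonPos⇒nonPos x {{nonPositive x≤0}} x {{nonPositive x≤0}}}}

  x*x≤y*y⇒x≤y : ∀ {x y} → 0ℚ ≤ y → x * x ≤ y * y → x ≤ y
  x*x≤y*y⇒x≤y {x} {y} 0≤y xx≤yy with <-cmp x y
  ... | tri< x<y _ _ = <⇒≤ x<y
  ... | tri≈ _ x≡y _ = ≤-reflexive x≡y
  ... | tri> _ _ y<x = ⊥-elim (<-irrefl refl (<-≤-trans yy<xx xx≤yy))
    where
    yy<xx : y * y < x * x
    yy<xx = begin-strict
      y * y ≤⟨ *-monoˡ-≤-nonNeg y {{nonNegative 0≤y}} (<⇒≤ y<x) ⟩
      y * x <⟨ *-monoˡ-<-pos x {{positive (≤-<-trans 0≤y y<x)}} y<x ⟩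
      x * x ∎

  x≤x+y : ∀ {x y} → 0ℚ ≤ y → x ≤ x + y
  x≤x+y {x} {y} 0≤y = subst (_≤ x + y) (+-identityʳ x) (+-monoʳ-≤ x 0≤y)

  -- AM-GM: (2x)² ≤ 4uv = (u + v)² - (u - v)².
  x*x≤u*v⇒x+x≤u+v : ∀ {x u v} → 0ℚ ≤ u → 0ℚ ≤ v → x * x ≤ u * v → x + x ≤ u + v
  x*x≤u*v⇒x+x≤u+v {x} {u} {v} 0≤u 0≤v xx≤uv = x*x≤y*y⇒x≤y (+-mono-≤ 0≤u 0≤v) (begin
    (x + x) * (x + x)                                 ≡⟨ solve 1 (λ x → (x :+ x) :* (x :+ x) := x :* x :+ x :* x :+ x :* x :+ x :* x) refl x ⟩
    x * x + x * x + x * x + x * x                     ≤⟨ +-mono-≤ (+-mono-≤ (+-mono-≤ xx≤uv xx≤uv) xx≤uv) xx≤uv ⟩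
    u * v + u * v + u * v + u * v                     ≤⟨ x≤x+y (x*x-nonNeg (u - v)) ⟩
    u * v + u * v + u * v + u * v + (u - v) * (u - v) ≡⟨ solve 2 (λ u v → u :* v :+ u :* v :+ u :* v :+ u :* v :+ (u :- v) :* (u :- v) := (u :+ v) :* (u :+ v)) refl u v ⟩
    (u + v) * (u + v)                                 ∎)
    where open +-*-Solver

  +-cauchySchwarz : ∀ {z s x y a b} → 0ℚ ≤ x → 0ℚ ≤ y → 0ℚ ≤ a → 0ℚ ≤ b →
                    z * z ≤ x * y → s * s ≤ a * b → (z + s) * (z + s) ≤ (x + a) * (y + b)
  +-cauchySchwarz {z} {s} {x} {y} {a} {b} 0≤x 0≤y 0≤a 0≤b zz≤xy ss≤ab = begin
    (z + s) * (z + s)                     ≡⟨ solve 2 (λ z s → (z :+ s) :* (z :+ s) := (z :* z :+ s :* s) :+ (z :* s :+ z :* s)) refl z s ⟩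
    (z * z + s * s) + (z * s + z * s)     ≤⟨ +-mono-≤ (+-mono-≤ zz≤xy ss≤ab) (x*x≤u*v⇒x+x≤u+v {z * s} (*-nonNeg 0≤x 0≤b) (*-nonNeg 0≤a 0≤y) zs²≤) ⟩
    (x * y + a * b) + (x * b + a * y)     ≡⟨ solve 4 (λ x y a b → (x :* y :+ a :* b) :+ (x :* b :+ a :* y) := (x :+ a) :* (y :+ b)) refl x y a b ⟩
    (x + a) * (y + b)                     ∎
    where
    open +-*-Solver
    zs²≤ : (z * s) * (z * s) ≤ (x * b) * (a * y)
    zs²≤ = begin
      (z * s) * (z * s) ≡⟨ solve 2 (λ z s → (z :* s) :* (z :* s) := (z :* z) :* (s :* s)) refl z s ⟩
      (z * z) * (s * s) ≤⟨ *-mono-≤-nonNeg (x*x-nonNeg z) (x*x-nonNeg s) zz≤xy ss≤ab ⟩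
      (x * y) * (a * b) ≡⟨ solve 4 (λ x y a b → (x :* y) :* (a :* b) := (x :* b) :* (a :* y)) refl x y a b ⟩
      (x * b) * (a * y) ∎

module _ where
  open ≡-Reasoning

  sumQ-cong : ∀ (xs : List X) {f g : X → ℚ} → (∀ x → f x ≡ g x) → sumQ xs f ≡ sumQ xs g
  sumQ-cong []       f≗g = refl
  sumQ-cong (x ∷ xs) f≗g = cong₂ _+_ (f≗g x) (sumQ-cong xs f≗g)

  sumQ-++ : ∀ (xs ys : List X) f → sumQ (xs ++ ys) f ≡ sumQ xs f + sumQ ys f
  sumQ-++ []       ys f = sym (+-identityˡ _)
  sumQ-++ (x ∷ xs) ys f = trans (cong (_+_ (f x)) (sumQ-++ xs ys f)) (sym (+-assoc (f x) _ _))

  sumQ-map : ∀ (k : X → Y) xs f → sumQ (map k xs) f ≡ sumQ xs (f ∘ k)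
  sumQ-map k []       f = refl
  sumQ-map k (x ∷ xs) f = cong (_+_ (f (k x))) (sumQ-map k xs f)

  sumQ-concatMap : ∀ (g : X → List Y) xs f → sumQ (concatMap g xs) f ≡ sumQ xs (λ x → sumQ (g x) f)
  sumQ-concatMap g []       f = refl
  sumQ-concatMap g (x ∷ xs) f =
    trans (sumQ-++ (g x) (concatMap g xs) f) (cong (_+_ (sumQ (g x) f)) (sumQ-concatMap g xs f))

  sumQ-*ˡ : ∀ c (xs : List X) f → sumQ xs (λ x → c * f x) ≡ c * sumQ xs f
  sumQ-*ˡ c []       f = sym (*-zeroʳ c)
  sumQ-*ˡ c (x ∷ xs) f = trans (cong (_+_ (c * f x)) (sumQ-*ˡ c xs f)) (sym (*-distribˡ-+ c (f x) _))

  sumQ-*ʳ : ∀ c (xs : List X) f → sumQ xs (λ x → f x * c) ≡ sumQ xs f * c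
  sumQ-*ʳ c xs f = trans (sumQ-cong xs (λ x → *-comm (f x) c)) (trans (sumQ-*ˡ c xs f) (*-comm c _))

  sumQ-+ : ∀ (xs : List X) f g → sumQ xs (λ x → f x + g x) ≡ sumQ xs f + sumQ xs g
  sumQ-+ []       f g = refl
  sumQ-+ (x ∷ xs) f g = trans (cong (_+_ (f x + g x)) (sumQ-+ xs f g))
    (solve 4 (λ a b c d → (a :+ b) :+ (c :+ d) := (a :+ c) :+ (b :+ d)) refl (f x) (g x) (sumQ xs f) (sumQ xs g))
    where open +-*-Solver

  sumQ-zero : ∀ (xs : List X) → sumQ xs (λ _ → 0ℚ) ≡ 0ℚ
  sumQ-zero []       = refl
  sumQ-zero (x ∷ xs) = trans (+-identityˡ _) (sumQ-zero xs)

  sumQ-const : ∀ (xs : List X) c → sumQ xs (λ _ → c) ≡ fromℕ (length xs) * c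
  sumQ-const []       c = sym (*-zeroˡ c)
  sumQ-const (x ∷ xs) c = begin
    c + sumQ xs (λ _ → c)           ≡⟨ cong₂ _+_ (sym (*-identityˡ c)) (sumQ-const xs c) ⟩
    1ℚ * c + fromℕ (length xs) * c  ≡⟨ sym (*-distribʳ-+ c 1ℚ (fromℕ (length xs))) ⟩
    (1ℚ + fromℕ (length xs)) * c    ≡⟨ cong (_* c) (sym (fromℕ-suc (length xs))) ⟩
    fromℕ (suc (length xs)) * c     ∎

  sumQ-swap : ∀ (xs : List X) (ys : List Y) (φ : X → Y → ℚ) →
    sumQ xs (λ x → sumQ ys (φ x)) ≡ sumQ ys (λ y → sumQ xs (λ x → φ x y))
  sumQ-swap []       ys φ = sym (sumQ-zero ys)
  sumQ-swap (x ∷ xs) ys φ = trans (cong (_+_ (sumQ ys (φ x))) (sumQ-swap xs ys φ))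
    (sym (sumQ-+ ys (φ x) (λ y → sumQ xs (λ x′ → φ x′ y))))

sumQ-mono : ∀ (xs : List X) {f g : X → ℚ} → (∀ x → f x ≤ g x) → sumQ xs f ≤ sumQ xs g
sumQ-mono []       f≤g = ≤-refl
sumQ-mono (x ∷ xs) f≤g = +-mono-≤ (f≤g x) (sumQ-mono xs f≤g)

sumQ-nonNeg : ∀ (xs : List X) {f : X → ℚ} → (∀ x → 0ℚ ≤ f x) → 0ℚ ≤ sumQ xs f
sumQ-nonNeg xs {f} 0≤f = subst (_≤ sumQ xs f) (sumQ-zero xs) (sumQ-mono xs 0≤f)

sumQ-cauchySchwarz : ∀ (xs : List X) (z f g : X → ℚ) → (∀ x → 0ℚ ≤ f x) → (∀ x → 0ℚ ≤ g x) →
  (∀ x → z x * z x ≤ f x * g x) → sumQ xs z * sumQ xs z ≤ sumQ xs f * sumQ xs g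
sumQ-cauchySchwarz []       z f g _   _   _     = ≤-refl
sumQ-cauchySchwarz (x ∷ xs) z f g 0≤f 0≤g z²≤fg =
  +-cauchySchwarz {z x} (0≤f x) (0≤g x) (sumQ-nonNeg xs 0≤f) (sumQ-nonNeg xs 0≤g)
    (z²≤fg x) (sumQ-cauchySchwarz xs z f g 0≤f 0≤g z²≤fg)

avg≡sumQ*invℕ : ∀ (xs : List X) f → avg xs f ≡ sumQ xs f * invℕ (length xs)
avg≡sumQ*invℕ []       f = sym (*-zeroˡ 0ℚ)
avg≡sumQ*invℕ (x ∷ xs) f = refl

module _ where
  open ≡-Reasoning

  avg-cong : ∀ (xs : List X) {f g : X → ℚ} → (∀ x → f x ≡ g x) → avg xs f ≡ avg xs g
  avg-cong xs {f} {g} f≗g = begin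
    avg xs f                         ≡⟨ avg≡sumQ*invℕ xs f ⟩
    sumQ xs f * invℕ (length xs)     ≡⟨ cong (_* invℕ (length xs)) (sumQ-cong xs f≗g) ⟩
    sumQ xs g * invℕ (length xs)     ≡⟨ avg≡sumQ*invℕ xs g ⟨
    avg xs g                         ∎

  avg-*ˡ : ∀ c (xs : List X) f → avg xs (λ x → c * f x) ≡ c * avg xs f
  avg-*ˡ c xs f = begin
    avg xs (λ x → c * f x)                  ≡⟨ avg≡sumQ*invℕ xs _ ⟩
    sumQ xs (λ x → c * f x) * invℕ (length xs) ≡⟨ cong (_* invℕ (length xs)) (sumQ-*ˡ c xs f) ⟩
    c * sumQ xs f * invℕ (length xs)        ≡⟨ *-assoc c _ _ ⟩
    c * (sumQ xs f * invℕ (length xs))      ≡⟨ cong (c *_) (avg≡sumQ*invℕ xs f) ⟨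
    c * avg xs f                            ∎

  avg-*ʳ : ∀ c (xs : List X) f → avg xs (λ x → f x * c) ≡ avg xs f * c
  avg-*ʳ c xs f = trans (avg-cong xs (λ x → *-comm (f x) c)) (trans (avg-*ˡ c xs f) (*-comm c _))

  avg-+ : ∀ (xs : List X) f g → avg xs (λ x → f x + g x) ≡ avg xs f + avg xs g
  avg-+ xs f g = begin
    avg xs (λ x → f x + g x)                      ≡⟨ avg≡sumQ*invℕ xs _ ⟩
    sumQ xs (λ x → f x + g x) * invℕ (length xs)  ≡⟨ cong (_* invℕ (length xs)) (sumQ-+ xs f g) ⟩
    (sumQ xs f + sumQ xs g) * invℕ (length xs)    ≡⟨ *-distribʳ-+ (invℕ (length xs)) (sumQ xs f) (sumQ xs g) ⟩
    sumQ xs f * invℕ (length xs) + sumQ xs g * invℕ (length xs)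
                                                  ≡⟨ cong₂ _+_ (avg≡sumQ*invℕ xs f) (avg≡sumQ*invℕ xs g) ⟨
    avg xs f + avg xs g                           ∎

  avg-swap : ∀ (xs : List X) (ys : List Y) (φ : X → Y → ℚ) →
    avg xs (λ x → avg ys (φ x)) ≡ avg ys (λ y → avg xs (λ x → φ x y))
  avg-swap xs ys φ = begin
    avg xs (λ x → avg ys (φ x))                        ≡⟨ avg-cong xs (λ x → avg≡sumQ*invℕ ys (φ x)) ⟩
    avg xs (λ x → sumQ ys (φ x) * v)                   ≡⟨ avg-*ʳ v xs _ ⟩
    avg xs (λ x → sumQ ys (φ x)) * v                   ≡⟨ cong (_* v) (avg≡sumQ*invℕ xs _) ⟩
    sumQ xs (λ x → sumQ ys (φ x)) * u * v              ≡⟨ cong (λ t → t * u * v) (sumQ-swap xs ys φ) ⟩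
    sumQ ys (λ y → sumQ xs (λ x → φ x y)) * u * v      ≡⟨ solve 3 (λ a b c → a :* b :* c := a :* c :* b) refl (sumQ ys (λ y → sumQ xs (λ x → φ x y))) u v ⟩
    sumQ ys (λ y → sumQ xs (λ x → φ x y)) * v * u      ≡⟨ cong (_* u) (avg≡sumQ*invℕ ys _) ⟨
    avg ys (λ y → sumQ xs (λ x → φ x y)) * u           ≡⟨ avg-*ʳ u ys _ ⟨
    avg ys (λ y → sumQ xs (λ x → φ x y) * u)           ≡⟨ avg-cong ys (λ y → avg≡sumQ*invℕ xs (λ x → φ x y)) ⟨
    avg ys (λ y → avg xs (λ x → φ x y))                ∎
    where
    open +-*-Solver
    u = invℕ (length xs)
    v = invℕ (length ys)

  length-concatMap-map : ∀ (k : X → Y → Z) (xs : List X) (ys : List Y) →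
    length (concatMap (λ x → map (k x) ys) xs) ≡ length xs ℕ.* length ys
  length-concatMap-map k []       ys = refl
  length-concatMap-map k (x ∷ xs) ys = trans (Listₚ.length-++ (map (k x) ys))
    (cong₂ ℕ._+_ (Listₚ.length-map (k x) ys) (length-concatMap-map k xs ys))

  avg-concatMap-map : ∀ (k : X → Y → Z) (xs : List X) (ys : List Y) (φ : Z → ℚ) →
    avg (concatMap (λ x → map (k x) ys) xs) φ ≡ avg xs (λ x → avg ys (λ y → φ (k x y)))
  avg-concatMap-map k xs ys φ = begin
    avg xys φ                                       ≡⟨ avg≡sumQ*invℕ xys φ ⟩
    sumQ xys φ * invℕ (length xys)                  ≡⟨ cong₂ _*_ sum-xys (cong invℕ (length-concatMap-map k xs ys)) ⟩
    σ * invℕ (length xs ℕ.* length ys)              ≡⟨ cong (σ *_) (invℕ-* (length xs) (length ys)) ⟩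
    σ * (u * v)                                     ≡⟨ solve 3 (λ a b c → a :* (b :* c) := a :* c :* b) refl σ u v ⟩
    σ * v * u                                       ≡⟨ cong (_* u) (sumQ-*ʳ v xs _) ⟨
    sumQ xs (λ x → sumQ ys (λ y → φ (k x y)) * v) * u ≡⟨ avg≡sumQ*invℕ xs _ ⟨
    avg xs (λ x → sumQ ys (λ y → φ (k x y)) * v)    ≡⟨ avg-cong xs (λ x → avg≡sumQ*invℕ ys _) ⟨
    avg xs (λ x → avg ys (λ y → φ (k x y)))         ∎
    where
    open +-*-Solver
    xys = concatMap (λ x → map (k x) ys) xs
    σ = sumQ xs (λ x → sumQ ys (λ y → φ (k x y)))
    u = invℕ (length xs)
    v = invℕ (length ys)
    sum-xys : sumQ xys φ ≡ σ
    sum-xys = trans (sumQ-concatMap (λ x → map (k x) ys) xs φ) (sumQ-cong xs (λ x → sumQ-map (k x) ys φ))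

  avg-const : ∀ {xs : List X} → xs ≢ [] → ∀ c → avg xs (λ _ → c) ≡ c
  avg-const {xs = []}     xs≢[] c = ⊥-elim (xs≢[] refl)
  avg-const {xs = x ∷ xs} _     c = begin
    sumQ (x ∷ xs) (λ _ → c) * w  ≡⟨ cong (_* w) (sumQ-const (x ∷ xs) c) ⟩
    fromℕ (suc (length xs)) * c * w  ≡⟨ solve 3 (λ a b c → a :* b :* c := (a :* c) :* b) refl (fromℕ (suc (length xs))) c w ⟩
    fromℕ (suc (length xs)) * w * c  ≡⟨ cong (_* c) (fromℕ*invℕ (suc (length xs))) ⟩
    1ℚ * c                           ≡⟨ *-identityˡ c ⟩
    c                                ∎
    where
    open +-*-Solver
    w = invℕ (suc (length xs))

  avg-singleton : ∀ (x : X) f → avg (x ∷ []) f ≡ f x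
  avg-singleton x f = trans (*-identityʳ _) (+-identityʳ (f x))

  avg-map : ∀ (k : X → Y) xs f → avg (map k xs) f ≡ avg xs (f ∘ k)
  avg-map k xs f = begin
    avg (map k xs) f                              ≡⟨ avg≡sumQ*invℕ (map k xs) f ⟩
    sumQ (map k xs) f * invℕ (length (map k xs))  ≡⟨ cong₂ _*_ (sumQ-map k xs f) (cong invℕ (Listₚ.length-map k xs)) ⟩
    sumQ xs (f ∘ k) * invℕ (length xs)            ≡⟨ avg≡sumQ*invℕ xs (f ∘ k) ⟨
    avg xs (f ∘ k)                                ∎

map≢[] : ∀ (f : X → Y) {xs} → xs ≢ [] → map f xs ≢ []
map≢[] f {[]}    xs≢[] _ = xs≢[] refl
map≢[] f {x ∷ xs} _    ()

avg-mono : ∀ (xs : List X) {f g : X → ℚ} → (∀ x → f x ≤ g x) → avg xs f ≤ avg xs g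
avg-mono xs {f} {g} f≤g = begin
  avg xs f                      ≡⟨ avg≡sumQ*invℕ xs f ⟩
  sumQ xs f * invℕ (length xs)  ≤⟨ *-monoʳ-≤-nonNeg _ {{nonNegative (invℕ-nonNeg (length xs))}} (sumQ-mono xs f≤g) ⟩
  sumQ xs g * invℕ (length xs)  ≡⟨ avg≡sumQ*invℕ xs g ⟨
  avg xs g                      ∎
  where open ≤-Reasoning

avg-nonNeg : ∀ (xs : List X) {f : X → ℚ} → (∀ x → 0ℚ ≤ f x) → 0ℚ ≤ avg xs f
avg-nonNeg xs {f} 0≤f = begin
  0ℚ                            ≡⟨ *-zeroˡ (invℕ (length xs)) ⟨
  0ℚ * invℕ (length xs)         ≤⟨ *-monoʳ-≤-nonNeg _ {{nonNegative (invℕ-nonNeg (length xs))}} (sumQ-nonNeg xs 0≤f) ⟩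
  sumQ xs f * invℕ (length xs)  ≡⟨ avg≡sumQ*invℕ xs f ⟨
  avg xs f                      ∎
  where open ≤-Reasoning

avg-cauchySchwarz : ∀ (xs : List X) (z f g : X → ℚ) → (∀ x → 0ℚ ≤ f x) → (∀ x → 0ℚ ≤ g x) →
  (∀ x → z x * z x ≤ f x * g x) → avg xs z * avg xs z ≤ avg xs f * avg xs g
avg-cauchySchwarz xs z f g 0≤f 0≤g z²≤fg = begin
  avg xs z * avg xs z                 ≡⟨ cong₂ _*_ (avg≡sumQ*invℕ xs z) (avg≡sumQ*invℕ xs z) ⟩
  (sumQ xs z * w) * (sumQ xs z * w)   ≡⟨ solve 2 (λ a w → (a :* w) :* (a :* w) := (a :* a) :* (w :* w)) refl (sumQ xs z) w ⟩
  (sumQ xs z * sumQ xs z) * (w * w)   ≤⟨ *-monoʳ-≤-nonNeg (w * w) {{nonNegative (x*x-nonNeg w)}} (sumQ-cauchySchwarz xs z f g 0≤f 0≤g z²≤fg) ⟩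
  (sumQ xs f * sumQ xs g) * (w * w)   ≡⟨ solve 3 (λ a b w → (a :* b) :* (w :* w) := (a :* w) :* (b :* w)) refl (sumQ xs f) (sumQ xs g) w ⟩
  (sumQ xs f * w) * (sumQ xs g * w)   ≡⟨ cong₂ _*_ (avg≡sumQ*invℕ xs f) (avg≡sumQ*invℕ xs g) ⟨
  avg xs f * avg xs g                 ∎
  where
  open ≤-Reasoning
  open +-*-Solver
  w = invℕ (length xs)

-- Gowers inner products on a finite abelian group

record AbelianLaws (H : FinGroup) : Set where
  open FinGroup H
  field
    ⊕-comm         : ∀ a b → a ⊕ b ≡ b ⊕ a
    ⊕-assoc        : ∀ a b c → (a ⊕ b) ⊕ c ≡ a ⊕ (b ⊕ c)
    sumQ-translate : ∀ (f : Carrier → ℚ) h → sumQ elems (λ x → f (x ⊕ h)) ≡ sumQ elems f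

module GowersInnerProduct (H : FinGroup) (laws : AbelianLaws H) where
  open FinGroup H
  open AbelianLaws laws

  𝔼 : (Carrier → ℚ) → ℚ
  𝔼 = avg elems

  𝔼-translate : ∀ f h → 𝔼 (λ x → f (x ⊕ h)) ≡ 𝔼 f
  𝔼-translate f h = trans (avg≡sumQ*invℕ elems _)
    (trans (cong (_* invℕ (length elems)) (sumQ-translate f h)) (sym (avg≡sumQ*invℕ elems f)))

  ⊕-swapʳ : ∀ z a b → (z ⊕ a) ⊕ b ≡ (z ⊕ b) ⊕ a
  ⊕-swapʳ z a b = trans (⊕-assoc z a b) (trans (cong (z ⊕_) (⊕-comm a b)) (sym (⊕-assoc z b a)))

  Family : ℕ → Set
  Family s = Vec Bool s → Carrier → ℚ

  Δᶠ : ∀ {s} → Carrier → Family (suc s) → Family s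
  Δᶠ h F ω z = F (false ∷ ω) z * F (true ∷ ω) (z ⊕ h)

  -- The Gowers inner product 𝔼_{x,h} ∏_ω F_ω(x + ω·h).
  innerProduct : ∀ s → Family s → ℚ
  innerProduct zero    F = 𝔼 (F [])
  innerProduct (suc s) F = 𝔼 (λ h → innerProduct s (Δᶠ h F))

  innerProduct-cong : ∀ s {F G : Family s} → (∀ ω z → F ω z ≡ G ω z) → innerProduct s F ≡ innerProduct s G
  innerProduct-cong zero    F≗G = avg-cong elems (F≗G [])
  innerProduct-cong (suc s) F≗G =
    avg-cong elems (λ h → innerProduct-cong s (λ ω z → cong₂ _*_ (F≗G _ z) (F≗G _ (z ⊕ h))))

  innerProduct-translate : ∀ s F t → innerProduct s (λ ω z → F ω (z ⊕ t)) ≡ innerProduct s F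
  innerProduct-translate zero    F t = 𝔼-translate (F []) t
  innerProduct-translate (suc s) F t = avg-cong elems (λ h → trans
    (innerProduct-cong s (λ ω z → cong (F (false ∷ ω) (z ⊕ t) *_) (cong (F (true ∷ ω)) (⊕-swapʳ z h t))))
    (innerProduct-translate s (Δᶠ h F) t))

  Δs-Δ : ∀ {s} (hs : Vec Carrier s) h f x → Δs H hs (Δ H h f) x ≡ Δ H h (Δs H hs f) x
  Δs-Δ []       h f x = refl
  Δs-Δ (k ∷ ks) h f x = begin
    Δs H ks (Δ H h f) x * Δs H ks (Δ H h f) (x ⊕ k)
      ≡⟨ cong₂ _*_ (Δs-Δ ks h f x) (Δs-Δ ks h f (x ⊕ k)) ⟩
    (D x * D (x ⊕ h)) * (D (x ⊕ k) * D ((x ⊕ k) ⊕ h))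
      ≡⟨ cong (λ w → (D x * D (x ⊕ h)) * (D (x ⊕ k) * D w)) (⊕-swapʳ x k h) ⟩
    (D x * D (x ⊕ h)) * (D (x ⊕ k) * D ((x ⊕ h) ⊕ k))
      ≡⟨ solve 4 (λ a b c d → (a :* b) :* (c :* d) := (a :* c) :* (b :* d)) refl (D x) (D (x ⊕ h)) (D (x ⊕ k)) (D ((x ⊕ h) ⊕ k)) ⟩
    (D x * D (x ⊕ k)) * (D (x ⊕ h) * D ((x ⊕ h) ⊕ k)) ∎
    where
    open ≡-Reasoning
    open +-*-Solver
    D = Δs H ks f

  gowersPow≡innerProduct : ∀ s f → gowersPow H s f ≡ innerProduct s (λ _ → f)
  gowersPow≡innerProduct zero    f = avg-cong elems (λ x → avg-singleton [] (λ hs → Δs H hs f x))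
  gowersPow≡innerProduct (suc s) f = begin
    𝔼 (λ x → avg (tuples H (suc s)) (λ hs → Δs H hs f x))
      ≡⟨ avg-cong elems (λ x → avg-concatMap-map _∷_ elems (tuples H s) (λ hs → Δs H hs f x)) ⟩
    𝔼 (λ x → 𝔼 (λ h → avg (tuples H s) (λ hs → Δ H h (Δs H hs f) x)))
      ≡⟨ avg-cong elems (λ x → avg-cong elems (λ h → avg-cong (tuples H s) (λ hs → sym (Δs-Δ hs h f x)))) ⟩
    𝔼 (λ x → 𝔼 (λ h → avg (tuples H s) (λ hs → Δs H hs (Δ H h f) x)))
      ≡⟨ avg-swap elems elems _ ⟩
    𝔼 (λ h → gowersPow H s (Δ H h f))
      ≡⟨ avg-cong elems (λ h → gowersPow≡innerProduct s (Δ H h f)) ⟩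
    innerProduct (suc s) (λ _ → f) ∎
    where open ≡-Reasoning

  gowersPow-cong : ∀ s {f g : Carrier → ℚ} → (∀ z → f z ≡ g z) → gowersPow H s f ≡ gowersPow H s g
  gowersPow-cong s {f} {g} f≗g = begin
    gowersPow H s f                ≡⟨ gowersPow≡innerProduct s f ⟩
    innerProduct s (λ _ → f)       ≡⟨ innerProduct-cong s (λ _ → f≗g) ⟩
    innerProduct s (λ _ → g)       ≡⟨ gowersPow≡innerProduct s g ⟨
    gowersPow H s g                ∎
    where open ≡-Reasoning

  swap₀₁ : ∀ {s} → Family (suc (suc s)) → Family (suc (suc s))
  swap₀₁ F (a ∷ b ∷ ω) = F (b ∷ a ∷ ω)

  innerProduct-swap₀₁ : ∀ s F → innerProduct (suc (suc s)) F ≡ innerProduct (suc (suc s)) (swap₀₁ F)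
  innerProduct-swap₀₁ s F = trans
    (avg-cong elems (λ h → avg-cong elems (λ k → innerProduct-cong s (Δᶠ-Δᶠ h k))))
    (avg-swap elems elems (λ h k → innerProduct s (Δᶠ h (Δᶠ k (swap₀₁ F)))))
    where
    open +-*-Solver
    Δᶠ-Δᶠ : ∀ h k ω z → Δᶠ k (Δᶠ h F) ω z ≡ Δᶠ h (Δᶠ k (swap₀₁ F)) ω z
    Δᶠ-Δᶠ h k ω z = trans
      (cong (λ w → (F (false ∷ false ∷ ω) z * F (true ∷ false ∷ ω) (z ⊕ h)) * (F (false ∷ true ∷ ω) (z ⊕ k) * F (true ∷ true ∷ ω) w)) (⊕-swapʳ z k h))
      (solve 4 (λ a b c d → (a :* b) :* (c :* d) := (a :* c) :* (b :* d)) refl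
        (F (false ∷ false ∷ ω) z) (F (true ∷ false ∷ ω) (z ⊕ h)) (F (false ∷ true ∷ ω) (z ⊕ k)) (F (true ∷ true ∷ ω) ((z ⊕ h) ⊕ k)))

  collapse : ∀ {s} → Fin s → Bool → Family s → Family s
  collapse j b F ω = F (ω [ j ]≔ b)

  𝔼-correlation : ∀ f g → 𝔼 (λ h → 𝔼 (λ x → f x * g (x ⊕ h))) ≡ 𝔼 f * 𝔼 g
  𝔼-correlation f g = begin
    𝔼 (λ h → 𝔼 (λ x → f x * g (x ⊕ h))) ≡⟨ avg-swap elems elems (λ h x → f x * g (x ⊕ h)) ⟩
    𝔼 (λ x → 𝔼 (λ h → f x * g (x ⊕ h))) ≡⟨ avg-cong elems (λ x → avg-*ˡ (f x) elems _) ⟩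
    𝔼 (λ x → f x * 𝔼 (λ h → g (x ⊕ h))) ≡⟨ avg-cong elems (λ x → cong (f x *_) (g-average x)) ⟩
    𝔼 (λ x → f x * 𝔼 g)                 ≡⟨ avg-*ʳ (𝔼 g) elems f ⟩
    𝔼 f * 𝔼 g                           ∎
    where
    open ≡-Reasoning
    g-average : ∀ x → 𝔼 (λ h → g (x ⊕ h)) ≡ 𝔼 g
    g-average x = trans (avg-cong elems (λ h → cong g (⊕-comm x h))) (𝔼-translate g x)

  innerProduct-collapse₀ : ∀ s b F →
    innerProduct (suc (suc s)) (collapse Fin.zero b F) ≡ 𝔼 (λ h → innerProduct (suc s) (collapse Fin.zero b (Δᶠ h (swap₀₁ F))))
  innerProduct-collapse₀ s b F = trans (innerProduct-swap₀₁ s (collapse Fin.zero b F))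
    (avg-cong elems (λ h → innerProduct-cong (suc s)
      {Δᶠ h (swap₀₁ (collapse Fin.zero b F))} {collapse Fin.zero b (Δᶠ h (swap₀₁ F))} λ { (a ∷ ω) z → refl }))

  innerProduct-collapse₀-nonNeg : ∀ s b F → 0ℚ ≤ innerProduct (suc s) (collapse Fin.zero b F)
  innerProduct-collapse₀-nonNeg zero    b F =
    subst (0ℚ ≤_) (sym (𝔼-correlation (F (b ∷ [])) (F (b ∷ [])))) (x*x-nonNeg (𝔼 (F (b ∷ []))))
  innerProduct-collapse₀-nonNeg (suc s) b F = subst (0ℚ ≤_) (sym (innerProduct-collapse₀ s b F))
    (avg-nonNeg elems (λ h → innerProduct-collapse₀-nonNeg s b (Δᶠ h (swap₀₁ F))))

  -- After swapping the first two coordinates, ⟨F⟩ is an average over h of inner products of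
  -- dimension one less that still contain coordinate 0, so Cauchy–Schwarz for 𝔼 and induction apply.
  innerProduct-cauchySchwarz₀ : ∀ s F →
    innerProduct (suc s) F * innerProduct (suc s) F
      ≤ innerProduct (suc s) (collapse Fin.zero false F) * innerProduct (suc s) (collapse Fin.zero true F)
  innerProduct-cauchySchwarz₀ zero F = ≤-reflexive (begin-equality
    innerProduct 1 F * innerProduct 1 F   ≡⟨ cong₂ _*_ (𝔼-correlation f₀ f₁) (𝔼-correlation f₀ f₁) ⟩
    (𝔼 f₀ * 𝔼 f₁) * (𝔼 f₀ * 𝔼 f₁)         ≡⟨ solve 2 (λ a b → (a :* b) :* (a :* b) := (a :* a) :* (b :* b)) refl (𝔼 f₀) (𝔼 f₁) ⟩
    (𝔼 f₀ * 𝔼 f₀) * (𝔼 f₁ * 𝔼 f₁)         ≡⟨ cong₂ _*_ (𝔼-correlation f₀ f₀) (𝔼-correlation f₁ f₁) ⟨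
    innerProduct 1 (collapse Fin.zero false F) * innerProduct 1 (collapse Fin.zero true F) ∎)
    where
    open ≤-Reasoning
    open +-*-Solver
    f₀ = F (false ∷ [])
    f₁ = F (true ∷ [])
  innerProduct-cauchySchwarz₀ (suc s) F = begin
    innerProduct (suc (suc s)) F * innerProduct (suc (suc s)) F
      ≡⟨ cong₂ _*_ (innerProduct-swap₀₁ s F) (innerProduct-swap₀₁ s F) ⟩
    𝔼 (I F′) * 𝔼 (I F′)
      ≤⟨ avg-cauchySchwarz elems (I F′) (I (collapse Fin.zero false ∘ F′)) (I (collapse Fin.zero true ∘ F′))
           (λ h → innerProduct-collapse₀-nonNeg s false (F′ h)) (λ h → innerProduct-collapse₀-nonNeg s true (F′ h))
           (λ h → innerProduct-cauchySchwarz₀ s (F′ h)) ⟩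
    𝔼 (I (collapse Fin.zero false ∘ F′)) * 𝔼 (I (collapse Fin.zero true ∘ F′))
      ≡⟨ cong₂ _*_ (innerProduct-collapse₀ s false F) (innerProduct-collapse₀ s true F) ⟨
    innerProduct (suc (suc s)) (collapse Fin.zero false F) * innerProduct (suc (suc s)) (collapse Fin.zero true F) ∎
    where
    open ≤-Reasoning
    F′ : Carrier → Family (suc s)
    F′ h = Δᶠ h (swap₀₁ F)
    I : (Carrier → Family (suc s)) → Carrier → ℚ
    I G h = innerProduct (suc s) (G h)

  innerProduct-collapse-nonNeg : ∀ s j b F → 0ℚ ≤ innerProduct s (collapse j b F)
  innerProduct-collapse-nonNeg (suc s) Fin.zero    b F = innerProduct-collapse₀-nonNeg s b F
  innerProduct-collapse-nonNeg (suc s) (Fin.suc j) b F =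
    avg-nonNeg elems (λ h → innerProduct-collapse-nonNeg s j b (Δᶠ h F))

  innerProduct-cauchySchwarz : ∀ s j F →
    innerProduct s F * innerProduct s F ≤ innerProduct s (collapse j false F) * innerProduct s (collapse j true F)
  innerProduct-cauchySchwarz (suc s) Fin.zero    F = innerProduct-cauchySchwarz₀ s F
  innerProduct-cauchySchwarz (suc s) (Fin.suc j) F = avg-cauchySchwarz elems
    (λ h → innerProduct s (Δᶠ h F)) (λ h → innerProduct s (collapse j false (Δᶠ h F))) (λ h → innerProduct s (collapse j true (Δᶠ h F)))
    (λ h → innerProduct-collapse-nonNeg s j false (Δᶠ h F)) (λ h → innerProduct-collapse-nonNeg s j true (Δᶠ h F))
    (λ h → innerProduct-cauchySchwarz s j (Δᶠ h F))

  gowersPow-nonNeg : ∀ s f → 0ℚ ≤ gowersPow H (suc s) f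
  gowersPow-nonNeg s f = subst (0ℚ ≤_)
    (trans (innerProduct-cong (suc s) {collapse Fin.zero false (λ _ → f)} (λ _ _ → refl)) (sym (gowersPow≡innerProduct (suc s) f)))
    (innerProduct-collapse-nonNeg (suc s) Fin.zero false (λ _ → f))

  ConstantFrom : ∀ {s} → ℕ → Family s → Set
  ConstantFrom {s} k F = ∀ (j : Fin s) → k ℕ.≤ toℕ j → ∀ ω b z → F (ω [ j ]≔ b) z ≡ F ω z

  constantFrom-zero : ∀ s (F : Family s) → ConstantFrom 0 F → ∀ ω z → F ω z ≡ F (replicate s false) z
  constantFrom-zero zero    F const [] z = refl
  constantFrom-zero (suc s) F const (b ∷ ω) z = trans (const Fin.zero ℕ.z≤n (false ∷ ω) b z)
    (constantFrom-zero s (λ ω′ → F (false ∷ ω′)) (λ j _ → const (Fin.suc j) ℕ.z≤n ∘ (false ∷_)) ω z)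

  collapse-constantFrom : ∀ {s k} (k<s : k ℕ.< s) b (F : Family s) →
    ConstantFrom (suc k) F → ConstantFrom k (collapse (Fin.fromℕ< k<s) b F)
  collapse-constantFrom {k = k} k<s b F const j k≤j ω b′ z with j Fin.≟ Fin.fromℕ< k<s
  ... | yes refl = cong (λ ω′ → F ω′ z) (Vecₚ.[]≔-idempotent ω j)
  ... | no j≢k = trans (cong (λ ω′ → F ω′ z) (Vecₚ.[]≔-commutes ω j (Fin.fromℕ< k<s) j≢k))
                       (const j k<j (ω [ Fin.fromℕ< k<s ]≔ b) b′ z)
    where
    k<j : k ℕ.< toℕ j
    k<j = ℕₚ.≤∧≢⇒< k≤j (λ k≡j → j≢k (Finₚ.toℕ-injective (trans (sym k≡j) (sym (Finₚ.toℕ-fromℕ< k<s)))))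

  gowersCauchySchwarz-from : ∀ s k → k ℕ.≤ s → ∀ F {M} → ConstantFrom k F →
    (∀ ω → gowersPow H s (F ω) ≡ M) → 0ℚ ≤ M → innerProduct s F ≤ M
  gowersCauchySchwarz-from s zero _ F const ‖F‖≡M _ = ≤-reflexive (begin-equality
    innerProduct s F                        ≡⟨ innerProduct-cong s (constantFrom-zero s F const) ⟩
    innerProduct s (λ _ → F (replicate s false)) ≡⟨ gowersPow≡innerProduct s (F (replicate s false)) ⟨
    gowersPow H s (F (replicate s false))   ≡⟨ ‖F‖≡M (replicate s false) ⟩
    _                                       ∎)
    where open ≤-Reasoning
  gowersCauchySchwarz-from s (suc k) k<s F {M} const ‖F‖≡M 0≤M = x*x≤y*y⇒x≤y 0≤M (begin
    innerProduct s F * innerProduct s F     ≤⟨ innerProduct-cauchySchwarz s j F ⟩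
    innerProduct s (collapse j false F) * innerProduct s (collapse j true F)
      ≤⟨ *-mono-≤-nonNeg (innerProduct-collapse-nonNeg s j false F) (innerProduct-collapse-nonNeg s j true F)
                         (collapsed≤M false) (collapsed≤M true) ⟩
    M * M                                   ∎)
    where
    open ≤-Reasoning
    j = Fin.fromℕ< k<s
    collapsed≤M : ∀ b → innerProduct s (collapse j b F) ≤ M
    collapsed≤M b = gowersCauchySchwarz-from s k (ℕₚ.<⇒≤ k<s) (collapse j b F)
      (collapse-constantFrom k<s b F const) (λ ω → ‖F‖≡M (ω [ j ]≔ b)) 0≤M

  gowersCauchySchwarz : ∀ s F {M} → (∀ ω → gowersPow H s (F ω) ≡ M) → innerProduct s F ≤ M
  gowersCauchySchwarz zero    F ‖F‖≡M = ≤-reflexive (trans (sym (gowersPow≡innerProduct 0 (F []))) (‖F‖≡M []))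
  gowersCauchySchwarz (suc s) F {M} ‖F‖≡M = gowersCauchySchwarz-from (suc s) (suc s) ℕₚ.≤-refl F
    (λ j s≤j → ⊥-elim (ℕₚ.<⇒≱ (Finₚ.toℕ<n j) s≤j)) ‖F‖≡M
    (subst (0ℚ ≤_) (‖F‖≡M (replicate (suc s) false)) (gowersPow-nonNeg s (F (replicate (suc s) false))))

  gowersPow-translate : ∀ s g t → gowersPow H s (λ z → g (z ⊕ t)) ≡ gowersPow H s g
  gowersPow-translate s g t = begin
    gowersPow H s (λ z → g (z ⊕ t))            ≡⟨ gowersPow≡innerProduct s _ ⟩
    innerProduct s (λ _ z → g (z ⊕ t))         ≡⟨ innerProduct-translate s (λ _ → g) t ⟩
    innerProduct s (λ _ → g)                   ≡⟨ gowersPow≡innerProduct s g ⟨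
    gowersPow H s g                            ∎
    where open ≡-Reasoning

  Δᶠ-linear-at : ∀ {Y : Set} {s} b (ω₀ : Vec Bool s) (T : List Y) (F : Family (suc s)) (G : Y → Family (suc s)) →
    (∀ t ω → ω ≢ b ∷ ω₀ → ∀ z → G t ω z ≡ F ω z) → (∀ z → F (b ∷ ω₀) z ≡ avg T (λ t → G t (b ∷ ω₀) z)) →
    ∀ h z → Δᶠ h F ω₀ z ≡ avg T (λ t → Δᶠ h (G t) ω₀ z)
  Δᶠ-linear-at false ω₀ T F G G≗F F≡avg h z = begin
    F (false ∷ ω₀) z * F (true ∷ ω₀) (z ⊕ h)                      ≡⟨ cong (_* F (true ∷ ω₀) (z ⊕ h)) (F≡avg z) ⟩
    avg T (λ t → G t (false ∷ ω₀) z) * F (true ∷ ω₀) (z ⊕ h)      ≡⟨ avg-*ʳ (F (true ∷ ω₀) (z ⊕ h)) T _ ⟨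
    avg T (λ t → G t (false ∷ ω₀) z * F (true ∷ ω₀) (z ⊕ h))      ≡⟨ avg-cong T (λ t → cong (G t (false ∷ ω₀) z *_) (sym (G≗F t (true ∷ ω₀) (λ ()) (z ⊕ h)))) ⟩
    avg T (λ t → G t (false ∷ ω₀) z * G t (true ∷ ω₀) (z ⊕ h))    ∎
    where open ≡-Reasoning
  Δᶠ-linear-at true ω₀ T F G G≗F F≡avg h z = begin
    F (false ∷ ω₀) z * F (true ∷ ω₀) (z ⊕ h)                      ≡⟨ cong (F (false ∷ ω₀) z *_) (F≡avg (z ⊕ h)) ⟩
    F (false ∷ ω₀) z * avg T (λ t → G t (true ∷ ω₀) (z ⊕ h))      ≡⟨ avg-*ˡ (F (false ∷ ω₀) z) T _ ⟨
    avg T (λ t → F (false ∷ ω₀) z * G t (true ∷ ω₀) (z ⊕ h))      ≡⟨ avg-cong T (λ t → cong (_* G t (true ∷ ω₀) (z ⊕ h)) (sym (G≗F t (false ∷ ω₀) (λ ()) z))) ⟩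
    avg T (λ t → G t (false ∷ ω₀) z * G t (true ∷ ω₀) (z ⊕ h))    ∎
    where open ≡-Reasoning

  innerProduct-linear-at : ∀ {Y : Set} s (ω₀ : Vec Bool s) (T : List Y) (F : Family s) (G : Y → Family s) →
    (∀ t ω → ω ≢ ω₀ → ∀ z → G t ω z ≡ F ω z) → (∀ z → F ω₀ z ≡ avg T (λ t → G t ω₀ z)) →
    innerProduct s F ≡ avg T (λ t → innerProduct s (G t))
  innerProduct-linear-at zero    []       T F G _   F≡avg = trans (avg-cong elems F≡avg) (avg-swap elems T (λ z t → G t [] z))
  innerProduct-linear-at (suc s) (b ∷ ω₀) T F G G≗F F≡avg = trans
    (avg-cong elems (λ h → innerProduct-linear-at s ω₀ T (Δᶠ h F) (λ t → Δᶠ h (G t)) (ΔG≗ΔF h) (Δᶠ-linear-at b ω₀ T F G G≗F F≡avg h)))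
    (avg-swap elems T (λ h t → innerProduct s (Δᶠ h (G t))))
    where
    ΔG≗ΔF : ∀ h t ω → ω ≢ ω₀ → ∀ z → Δᶠ h (G t) ω z ≡ Δᶠ h F ω z
    ΔG≗ΔF h t ω ω≢ω₀ z = cong₂ _*_ (G≗F t (false ∷ ω) (ω≢ω₀ ∘ Vecₚ.∷-injectiveʳ) z)
                                     (G≗F t (true ∷ ω) (ω≢ω₀ ∘ Vecₚ.∷-injectiveʳ) (z ⊕ h))

  _≟ω_ : ∀ {s} → DecidableEquality (Vec Bool s)
  _≟ω_ = Vecₚ.≡-dec Boolₚ._≟_

  update : ∀ {s} → Vec Bool s → (Carrier → ℚ) → Family s → Family s
  update ω₀ φ F ω = if does (ω ≟ω ω₀) then φ else F ω

  update-≡ : ∀ {s} (ω₀ : Vec Bool s) φ F z → update ω₀ φ F ω₀ z ≡ φ z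
  update-≡ ω₀ φ F z = cong (λ b → (if b then φ else F ω₀) z) (dec-true (ω₀ ≟ω ω₀) refl)

  update-≢ : ∀ {s} {ω ω₀ : Vec Bool s} φ F → ω ≢ ω₀ → ∀ z → update ω₀ φ F ω z ≡ F ω z
  update-≢ {ω = ω} {ω₀} φ F ω≢ω₀ z = cong (λ b → (if b then φ else F ω) z) (dec-false (ω ≟ω ω₀) ω≢ω₀)

  cube : ∀ s → List (Vec Bool s)
  cube zero    = [] ∷ []
  cube (suc s) = map (false ∷_) (cube s) ++ map (true ∷_) (cube s)

  ∈-cube : ∀ {s} (ω : Vec Bool s) → ω ∈ cube s
  ∈-cube []                = here refl
  ∈-cube {suc s} (false ∷ ω) = ∈-++⁺ˡ (∈-map⁺ (false ∷_) (∈-cube ω))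
  ∈-cube {suc s} (true ∷ ω)  = ∈-++⁺ʳ (map (false ∷_) (cube s)) (∈-map⁺ (true ∷_) (∈-cube ω))

  module _ (g : Carrier → ℚ) (T : List Carrier) (T≢[] : T ≢ []) where

    average : Carrier → ℚ
    average z = avg T (λ t → g (z ⊕ t))

    IsTranslate : (Carrier → ℚ) → Set
    IsTranslate φ = ∃ λ t → ∀ z → φ z ≡ g (z ⊕ t)

    Pending : ∀ {s} → List (Vec Bool s) → Family s → Set
    Pending Ω F = ∀ ω → IsTranslate (F ω) ⊎ (ω ∈ Ω × ∀ z → F ω z ≡ average z)

    pending-drop : ∀ {s} {ω₀} {Ω : List (Vec Bool s)} {F} → IsTranslate (F ω₀) → Pending (ω₀ ∷ Ω) F → Pending Ω F
    pending-drop F₀-translate pending ω with pending ω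
    ... | inj₁ translate                 = inj₁ translate
    ... | inj₂ (here refl  , _)          = inj₁ F₀-translate
    ... | inj₂ (there ω∈Ω , F≗average)   = inj₂ (ω∈Ω , F≗average)

    pending-update : ∀ {s} {ω₀} {Ω : List (Vec Bool s)} {F} t →
      Pending (ω₀ ∷ Ω) F → Pending Ω (update ω₀ (λ z → g (z ⊕ t)) F)
    pending-update {ω₀ = ω₀} {F = F} t pending ω with ω ≟ω ω₀ | pending ω
    ... | yes refl | _                              = inj₁ (t , λ _ → refl)
    ... | no ω≢ω₀  | inj₁ (t′ , F≗g)                = inj₁ (t′ , F≗g)
    ... | no ω≢ω₀  | inj₂ (here ω≡ω₀ , _)           = ⊥-elim (ω≢ω₀ ω≡ω₀)
    ... | no ω≢ω₀  | inj₂ (there ω∈Ω , F≗average)   = inj₂ (ω∈Ω , F≗average)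

    innerProduct-pending≤ : ∀ s Ω F → Pending Ω F → innerProduct s F ≤ gowersPow H s g
    innerProduct-pending≤ s [] F pending = gowersCauchySchwarz s F (λ ω → translate-gowersPow (pending ω))
      where
      translate-gowersPow : ∀ {ω} → IsTranslate (F ω) ⊎ (ω ∈ [] × _) → gowersPow H s (F ω) ≡ gowersPow H s g
      translate-gowersPow (inj₁ (t , φ≗g)) = trans (gowersPow-cong s φ≗g) (gowersPow-translate s g t)
      translate-gowersPow (inj₂ (() , _))
    innerProduct-pending≤ s (ω₀ ∷ Ω) F pending with pending ω₀
    ... | inj₁ translate = innerProduct-pending≤ s Ω F (pending-drop translate pending)
    ... | inj₂ (_ , F₀≗average) = begin
      innerProduct s F
        ≡⟨ innerProduct-linear-at s ω₀ T F G G≗F F₀≡avg ⟩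
      avg T (λ t → innerProduct s (G t))
        ≤⟨ avg-mono T (λ t → innerProduct-pending≤ s Ω (G t) (pending-update t pending)) ⟩
      avg T (λ _ → gowersPow H s g)
        ≡⟨ avg-const T≢[] (gowersPow H s g) ⟩
      gowersPow H s g ∎
      where
      open ≤-Reasoning
      G : Carrier → Family s
      G t = update ω₀ (λ z → g (z ⊕ t)) F
      G≗F : ∀ t ω → ω ≢ ω₀ → ∀ z → G t ω z ≡ F ω z
      G≗F t ω ω≢ω₀ = update-≢ _ F ω≢ω₀
      F₀≡avg : ∀ z → F ω₀ z ≡ avg T (λ t → G t ω₀ z)
      F₀≡avg z = trans (F₀≗average z) (avg-cong T (λ t → sym (update-≡ ω₀ _ F z)))

    gowersPow-average≤ : ∀ s → gowersPow H s average ≤ gowersPow H s g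
    gowersPow-average≤ s = subst (_≤ gowersPow H s g) (sym (gowersPow≡innerProduct s average))
      (innerProduct-pending≤ s (cube s) (λ _ → average) (λ ω → inj₂ (∈-cube ω , λ _ → refl)))

powQ-+ : ∀ c m n → powQ c (m ℕ.+ n) ≡ powQ c m * powQ c n
powQ-+ c zero    n = sym (*-identityˡ _)
powQ-+ c (suc m) n = trans (cong (c *_) (powQ-+ c m n)) (sym (*-assoc c _ _))

powQ-*-distrib : ∀ a b k → powQ (a * b) k ≡ powQ a k * powQ b k
powQ-*-distrib a b zero    = refl
powQ-*-distrib a b (suc k) = trans (cong (a * b *_) (powQ-*-distrib a b k))
  (solve 4 (λ a b x y → (a :* b) :* (x :* y) := (a :* x) :* (b :* y)) refl a b (powQ a k) (powQ b k))
  where open +-*-Solver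

powQ-one : ∀ k → powQ 1ℚ k ≡ 1ℚ
powQ-one zero    = refl
powQ-one (suc k) = trans (*-identityˡ _) (powQ-one k)

powQ-nonNeg : ∀ a k → 0ℚ ≤ a → 0ℚ ≤ powQ a k
powQ-nonNeg a zero    _   = fromℕ-nonNeg 1
powQ-nonNeg a (suc k) 0≤a = *-nonNeg 0≤a (powQ-nonNeg a k 0≤a)

module _ (H : FinGroup) where
  open FinGroup H

  Δs-* : ∀ {s} (hs : Vec Carrier s) c f x → Δs H hs (λ z → c * f z) x ≡ powQ c (2 ^ s) * Δs H hs f x
  Δs-* []               c f x = cong (_* f x) (sym (*-identityʳ c))
  Δs-* {suc s} (h ∷ hs) c f x = begin
    Δs H hs (λ z → c * f z) x * Δs H hs (λ z → c * f z) (x ⊕ h)  ≡⟨ cong₂ _*_ (Δs-* hs c f x) (Δs-* hs c f (x ⊕ h)) ⟩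
    (P * Δs H hs f x) * (P * Δs H hs f (x ⊕ h))                  ≡⟨ solve 3 (λ p a b → (p :* a) :* (p :* b) := (p :* p) :* (a :* b)) refl P (Δs H hs f x) (Δs H hs f (x ⊕ h)) ⟩
    (P * P) * (Δs H hs f x * Δs H hs f (x ⊕ h))                  ≡⟨ cong (_* (Δs H hs f x * Δs H hs f (x ⊕ h))) P*P ⟩
    powQ c (2 ^ suc s) * (Δs H hs f x * Δs H hs f (x ⊕ h))       ∎
    where
    open ≡-Reasoning
    open +-*-Solver
    P = powQ c (2 ^ s)
    P*P : P * P ≡ powQ c (2 ^ suc s)
    P*P = sym (trans (cong (powQ c) (cong (2 ^ s ℕ.+_) (ℕₚ.+-identityʳ (2 ^ s)))) (powQ-+ c (2 ^ s) (2 ^ s)))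

  gowersPow-* : ∀ s c f → gowersPow H s (λ z → c * f z) ≡ powQ c (2 ^ s) * gowersPow H s f
  gowersPow-* s c f = trans
    (avg-cong elems (λ x → trans (avg-cong (tuples H s) (λ hs → Δs-* hs c f x)) (avg-*ˡ (powQ c (2 ^ s)) (tuples H s) _)))
    (avg-*ˡ (powQ c (2 ^ s)) elems _)

_×ᴳ_ : FinGroup → FinGroup → FinGroup
H ×ᴳ K = record
  { Carrier = H.Carrier × K.Carrier
  ; elems   = cartesianProductWith _,_ H.elems K.elems
  ; _⊕_     = λ a b → (proj₁ a H.⊕ proj₁ b , proj₂ a K.⊕ proj₂ b)
  }
  where
  module H = FinGroup H
  module K = FinGroup K

cartesianProduct≡concatMap : ∀ (xs : List X) (ys : List Y) →
  cartesianProductWith _,_ xs ys ≡ concatMap (λ x → map (x ,_) ys) xs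
cartesianProduct≡concatMap []       ys = refl
cartesianProduct≡concatMap (x ∷ xs) ys = cong (map (x ,_) ys ++_) (cartesianProduct≡concatMap xs ys)

sumQ-cartesianProduct : ∀ (xs : List X) (ys : List Y) f →
  sumQ (cartesianProductWith _,_ xs ys) f ≡ sumQ xs (λ x → sumQ ys (λ y → f (x , y)))
sumQ-cartesianProduct xs ys f = trans (cong (λ l → sumQ l f) (cartesianProduct≡concatMap xs ys))
  (trans (sumQ-concatMap (λ x → map (x ,_) ys) xs f) (sumQ-cong xs (λ x → sumQ-map (x ,_) ys f)))

avg-cartesianProduct : ∀ (xs : List X) (ys : List Y) f →
  avg (cartesianProductWith _,_ xs ys) f ≡ avg xs (λ x → avg ys (λ y → f (x , y)))
avg-cartesianProduct xs ys f =
  trans (cong (λ l → avg l f) (cartesianProduct≡concatMap xs ys)) (avg-concatMap-map _,_ xs ys f)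

×-abelianLaws : ∀ {H K} → AbelianLaws H → AbelianLaws K → AbelianLaws (H ×ᴳ K)
×-abelianLaws {H} {K} lawsH lawsK = record
  { ⊕-comm         = λ a b → cong₂ _,_ (H.⊕-comm (proj₁ a) (proj₁ b)) (K.⊕-comm (proj₂ a) (proj₂ b))
  ; ⊕-assoc        = λ a b c → cong₂ _,_ (H.⊕-assoc (proj₁ a) (proj₁ b) (proj₁ c)) (K.⊕-assoc (proj₂ a) (proj₂ b) (proj₂ c))
  ; sumQ-translate = sumQ-translate
  }
  where
  module H = AbelianLaws lawsH
  module K = AbelianLaws lawsK
  open FinGroup H using () renaming (elems to xs; _⊕_ to _⊕ᴴ_)
  open FinGroup K using () renaming (elems to ys; _⊕_ to _⊕ᴷ_)

  sumQ-translate : ∀ f (h : FinGroup.Carrier (H ×ᴳ K)) →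
    sumQ (cartesianProductWith _,_ xs ys) (λ z → f (proj₁ z ⊕ᴴ proj₁ h , proj₂ z ⊕ᴷ proj₂ h))
      ≡ sumQ (cartesianProductWith _,_ xs ys) f
  sumQ-translate f (a , b) = begin
    sumQ (cartesianProductWith _,_ xs ys) (λ z → f (proj₁ z ⊕ᴴ a , proj₂ z ⊕ᴷ b))
                                                    ≡⟨ sumQ-cartesianProduct xs ys _ ⟩
    sumQ xs (λ x → sumQ ys (λ y → f (x ⊕ᴴ a , y ⊕ᴷ b))) ≡⟨ sumQ-cong xs (λ x → K.sumQ-translate (λ y → f (x ⊕ᴴ a , y)) b) ⟩
    sumQ xs (λ x → sumQ ys (λ y → f (x ⊕ᴴ a , y)))      ≡⟨ H.sumQ-translate (λ x → sumQ ys (λ y → f (x , y))) a ⟩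
    sumQ xs (λ x → sumQ ys (λ y → f (x , y)))           ≡⟨ sumQ-cartesianProduct xs ys f ⟨
    sumQ (cartesianProductWith _,_ xs ys) f             ∎
    where open ≡-Reasoning

module _ (H K : FinGroup) (K≢[] : FinGroup.elems K ≢ []) where
  open FinGroup H
  open FinGroup K using () renaming (elems to elemsK)

  Δs-∘proj₁ : ∀ {s} (hs : Vec (Carrier × FinGroup.Carrier K) s) φ x y →
    Δs (H ×ᴳ K) hs (φ ∘ proj₁) (x , y) ≡ Δs H (Vec.map proj₁ hs) φ x
  Δs-∘proj₁ []       φ x y = refl
  Δs-∘proj₁ (h ∷ hs) φ x y = cong₂ _*_ (Δs-∘proj₁ hs φ x y) (Δs-∘proj₁ hs φ _ _)

  avg-tuples-map-proj₁ : ∀ s (ψ : Vec Carrier s → ℚ) →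
    avg (tuples (H ×ᴳ K) s) (ψ ∘ Vec.map proj₁) ≡ avg (tuples H s) ψ
  avg-tuples-map-proj₁ zero    ψ = refl
  avg-tuples-map-proj₁ (suc s) ψ = begin
    avg (tuples (H ×ᴳ K) (suc s)) (ψ ∘ Vec.map proj₁)
      ≡⟨ avg-concatMap-map _∷_ (FinGroup.elems (H ×ᴳ K)) (tuples (H ×ᴳ K) s) _ ⟩
    avg (FinGroup.elems (H ×ᴳ K)) (λ h → avg (tuples (H ×ᴳ K) s) (λ hs → ψ (proj₁ h ∷ Vec.map proj₁ hs)))
      ≡⟨ avg-cong (FinGroup.elems (H ×ᴳ K)) (λ h → avg-tuples-map-proj₁ s (ψ ∘ (proj₁ h ∷_))) ⟩
    avg (FinGroup.elems (H ×ᴳ K)) (λ h → avg (tuples H s) (ψ ∘ (proj₁ h ∷_)))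
      ≡⟨ avg-cartesianProduct elems elemsK _ ⟩
    avg elems (λ x → avg elemsK (λ _ → avg (tuples H s) (ψ ∘ (x ∷_))))
      ≡⟨ avg-cong elems (λ x → avg-const K≢[] _) ⟩
    avg elems (λ x → avg (tuples H s) (ψ ∘ (x ∷_)))
      ≡⟨ avg-concatMap-map _∷_ elems (tuples H s) ψ ⟨
    avg (tuples H (suc s)) ψ ∎
    where open ≡-Reasoning

  gowersPow-∘proj₁ : ∀ s φ → gowersPow (H ×ᴳ K) s (φ ∘ proj₁) ≡ gowersPow H s φ
  gowersPow-∘proj₁ s φ = begin
    gowersPow (H ×ᴳ K) s (φ ∘ proj₁)
      ≡⟨ avg-cartesianProduct elems elemsK _ ⟩
    avg elems (λ x → avg elemsK (λ y → avg (tuples (H ×ᴳ K) s) (λ hs → Δs (H ×ᴳ K) hs (φ ∘ proj₁) (x , y))))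
      ≡⟨ avg-cong elems (λ x → avg-cong elemsK (λ y → trans (avg-cong (tuples (H ×ᴳ K) s) (λ hs → Δs-∘proj₁ hs φ x y))
                                                            (avg-tuples-map-proj₁ s (λ hs → Δs H hs φ x)))) ⟩
    avg elems (λ x → avg elemsK (λ _ → avg (tuples H s) (λ hs → Δs H hs φ x)))
      ≡⟨ avg-cong elems (λ x → avg-const K≢[] _) ⟩
    gowersPow H s φ ∎
    where open ≡-Reasoning

-- Arithmetic in Fp and Fp^n

module FpArithmetic (p : ℕ) .{{_ : NonZero p}} where

  -- Identities in Fp are reduced to ring identities between integer representatives modulo p.
  ⟦_⟧ : Fp p → ℤ
  ⟦ a ⟧ = + toℕ a

  infix 4 _≈_
  record _≈_ (x y : ℤ) : Set where
    constructor mod-p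
    field p∣x-y : + p ∣ x ℤ.- y

  private
    by : ∀ {u x y} → u ≡ x ℤ.- y → + p ∣ u → x ≈ y
    by eq = mod-p ∘ subst (+ p ∣_) eq

  ≈-refl : ∀ {x} → x ≈ x
  ≈-refl {x} = mod-p (subst (+ p ∣_) (sym (ℤₚ.+-inverseʳ x)) (divides (+ 0) refl))

  ≡⇒≈ : ∀ {x y} → x ≡ y → x ≈ y
  ≡⇒≈ {x} refl = ≈-refl {x}

  ≈-sym : ∀ {x y} → x ≈ y → y ≈ x
  ≈-sym {x} {y} (mod-p x≈y) = by (eq x y) (∣m⇒∣-m x≈y)
    where
    eq : ∀ x y → ℤ.- (x ℤ.- y) ≡ y ℤ.- x
    eq = solve-∀

  ≈-trans : ∀ {x y z} → x ≈ y → y ≈ z → x ≈ z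
  ≈-trans {x} {y} {z} (mod-p x≈y) (mod-p y≈z) = by (eq x y z) (∣m∣n⇒∣m+n x≈y y≈z)
    where
    eq : ∀ x y z → (x ℤ.- y) ℤ.+ (y ℤ.- z) ≡ x ℤ.- z
    eq = solve-∀

  ≈-+ : ∀ {x x′ y y′} → x ≈ x′ → y ≈ y′ → x ℤ.+ y ≈ x′ ℤ.+ y′
  ≈-+ {x} {x′} {y} {y′} (mod-p x≈x′) (mod-p y≈y′) = by (eq x x′ y y′) (∣m∣n⇒∣m+n x≈x′ y≈y′)
    where
    eq : ∀ x x′ y y′ → (x ℤ.- x′) ℤ.+ (y ℤ.- y′) ≡ (x ℤ.+ y) ℤ.- (x′ ℤ.+ y′)
    eq = solve-∀

  ≈-* : ∀ {x x′ y y′} → x ≈ x′ → y ≈ y′ → x ℤ.* y ≈ x′ ℤ.* y′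
  ≈-* {x} {x′} {y} {y′} (mod-p x≈x′) (mod-p y≈y′) = by (eq x x′ y y′) (∣m∣n⇒∣m+n (∣m⇒∣m*n y x≈x′) (∣n⇒∣m*n x′ y≈y′))
    where
    eq : ∀ x x′ y y′ → (x ℤ.- x′) ℤ.* y ℤ.+ x′ ℤ.* (y ℤ.- y′) ≡ x ℤ.* y ℤ.- x′ ℤ.* y′
    eq = solve-∀

  ≈-neg : ∀ {x x′} → x ≈ x′ → ℤ.- x ≈ ℤ.- x′
  ≈-neg {x} {x′} (mod-p x≈x′) = by (eq x x′) (∣m⇒∣-m x≈x′)
    where
    eq : ∀ x x′ → ℤ.- (x ℤ.- x′) ≡ ℤ.- x ℤ.- ℤ.- x′
    eq = solve-∀

  ⟦mod⟧ : ∀ m → ⟦ m mod p ⟧ ≈ + m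
  ⟦mod⟧ m = mod-p (divides (ℤ.- + (m ℕ./ p)) (begin
    ⟦ m mod p ⟧ ℤ.- + m                                ≡⟨ cong₂ ℤ._-_ (cong +_ (Finₚ.toℕ-fromℕ< (m%n<n m p))) m≡r+qp ⟩
    + (m % p) ℤ.- (+ (m % p) ℤ.+ + (m ℕ./ p) ℤ.* + p)  ≡⟨ eq (+ (m % p)) (+ (m ℕ./ p)) (+ p) ⟩
    ℤ.- + (m ℕ./ p) ℤ.* + p                            ∎))
    where
    open ≡-Reasoning
    m≡r+qp : + m ≡ + (m % p) ℤ.+ + (m ℕ./ p) ℤ.* + p
    m≡r+qp = trans (cong +_ (m≡m%n+[m/n]*n m p))
      (trans (ℤₚ.pos-+ (m % p) _) (cong (ℤ._+_ (+ (m % p))) (ℤₚ.pos-* (m ℕ./ p) p)))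
    eq : ∀ r q n → r ℤ.- (r ℤ.+ q ℤ.* n) ≡ ℤ.- q ℤ.* n
    eq = solve-∀

  ⟦+⟧ : ∀ a b {x y} → ⟦ a ⟧ ≈ x → ⟦ b ⟧ ≈ y → ⟦ _+p_ p a b ⟧ ≈ x ℤ.+ y
  ⟦+⟧ a b a≈x b≈y = ≈-trans (⟦mod⟧ (toℕ a ℕ.+ toℕ b)) (≈-trans (≡⇒≈ (ℤₚ.pos-+ (toℕ a) (toℕ b))) (≈-+ a≈x b≈y))

  ⟦*⟧ : ∀ a b {x y} → ⟦ a ⟧ ≈ x → ⟦ b ⟧ ≈ y → ⟦ _*p_ p a b ⟧ ≈ x ℤ.* y
  ⟦*⟧ a b a≈x b≈y = ≈-trans (⟦mod⟧ (toℕ a ℕ.* toℕ b)) (≈-trans (≡⇒≈ (ℤₚ.pos-* (toℕ a) (toℕ b))) (≈-* a≈x b≈y))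

  ⟦neg⟧ : ∀ a {x} → ⟦ a ⟧ ≈ x → ⟦ negp p a ⟧ ≈ ℤ.- x
  ⟦neg⟧ a a≈x = ≈-trans (⟦mod⟧ (p ℕ.∸ toℕ a)) (≈-trans p-a≈-a (≈-neg a≈x))
    where
    open ≡-Reasoning
    eq : ∀ u v → u ℤ.- ℤ.- v ≡ u ℤ.+ v
    eq = solve-∀
    p-a≈-a : + (p ℕ.∸ toℕ a) ≈ ℤ.- ⟦ a ⟧
    p-a≈-a = mod-p (divides (+ 1) (begin
      + (p ℕ.∸ toℕ a) ℤ.- ℤ.- ⟦ a ⟧   ≡⟨ eq (+ (p ℕ.∸ toℕ a)) ⟦ a ⟧ ⟩
      + (p ℕ.∸ toℕ a) ℤ.+ ⟦ a ⟧       ≡⟨ ℤₚ.pos-+ (p ℕ.∸ toℕ a) (toℕ a) ⟨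
      + (p ℕ.∸ toℕ a ℕ.+ toℕ a)       ≡⟨ cong +_ (ℕₚ.m∸n+n≡m (ℕₚ.<⇒≤ (Finₚ.toℕ<n a))) ⟩
      + p                             ≡⟨ ℤₚ.*-identityˡ (+ p) ⟨
      + 1 ℤ.* + p                     ∎))

  ⟦0⟧ : ⟦ 0p p ⟧ ≈ + 0
  ⟦0⟧ = ⟦mod⟧ 0

  ≈⇒≡ : ∀ {a b} → ⟦ a ⟧ ≈ ⟦ b ⟧ → a ≡ b
  ≈⇒≡ {a} {b} (mod-p a≈b) = Finₚ.toℕ-injective (ℤₚ.+-injective
    (ℤₚ.i-j≡0⇒i≡j _ _ (ℤₚ.∣i∣≡0⇒i≡0 (multiple<p⇒≡0 (∣⇒∣ᵤ a≈b) ∣a-b∣<p))))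
    where
    multiple<p⇒≡0 : ∀ {n} → p ℕ∣.∣ n → n ℕ.< p → n ≡ 0
    multiple<p⇒≡0 {zero}  _   _   = refl
    multiple<p⇒≡0 {suc n} p∣n n<p = ⊥-elim (ℕ∣.>⇒∤ n<p p∣n)
    ∣a-b∣<p : ℤ.∣ ⟦ a ⟧ ℤ.- ⟦ b ⟧ ∣ ℕ.< p
    ∣a-b∣<p = subst (ℕ._< p) (cong ℤ.∣_∣ (sym (ℤₚ.m-n≡m⊖n (toℕ a) (toℕ b))))
      (ℕₚ.≤-<-trans (ℤₚ.∣m⊝n∣≤m⊔n (toℕ a) (toℕ b)) (ℕₚ.⊔-lub (Finₚ.toℕ<n a) (Finₚ.toℕ<n b)))

  byℤ : ∀ a b {x y} → ⟦ a ⟧ ≈ x → x ≡ y → ⟦ b ⟧ ≈ y → a ≡ b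
  byℤ a b a≈x x≡y b≈y = ≈⇒≡ (≈-trans a≈x (≈-trans (≡⇒≈ x≡y) (≈-sym b≈y)))

  infixl 7 _*ₚ_
  infixl 6 _+ₚ_ _-ₚ_
  _+ₚ_ _-ₚ_ _*ₚ_ : Fp p → Fp p → Fp p
  _+ₚ_ = _+p_ p
  _*ₚ_ = _*p_ p
  a -ₚ b = a +ₚ negp p b

  ⟦-⟧ : ∀ a b {x y} → ⟦ a ⟧ ≈ x → ⟦ b ⟧ ≈ y → ⟦ a -ₚ b ⟧ ≈ x ℤ.- y
  ⟦-⟧ a b a≈x b≈y = ⟦+⟧ a (negp p b) a≈x (⟦neg⟧ b b≈y)

  +ₚ-comm : ∀ a b → a +ₚ b ≡ b +ₚ a
  +ₚ-comm a b = byℤ _ _ (⟦+⟧ a b ≈-refl ≈-refl) (ℤₚ.+-comm ⟦ a ⟧ ⟦ b ⟧) (⟦+⟧ b a ≈-refl ≈-refl)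

  +ₚ-assoc : ∀ a b c → (a +ₚ b) +ₚ c ≡ a +ₚ (b +ₚ c)
  +ₚ-assoc a b c = byℤ _ _ (⟦+⟧ (a +ₚ b) c (⟦+⟧ a b ≈-refl ≈-refl) ≈-refl) (ℤₚ.+-assoc ⟦ a ⟧ ⟦ b ⟧ ⟦ c ⟧)
                           (⟦+⟧ a (b +ₚ c) ≈-refl (⟦+⟧ b c ≈-refl ≈-refl))

  +ₚ-identityʳ : ∀ a → a +ₚ 0p p ≡ a
  +ₚ-identityʳ a = byℤ _ _ (⟦+⟧ a (0p p) ≈-refl ⟦0⟧) (ℤₚ.+-identityʳ ⟦ a ⟧) ≈-refl

  a-a≡0 : ∀ a → a -ₚ a ≡ 0p p
  a-a≡0 a = byℤ _ _ (⟦-⟧ a a ≈-refl ≈-refl) (ℤₚ.+-inverseʳ ⟦ a ⟧) ⟦0⟧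

  [a+b]-b≡a : ∀ a b → (a +ₚ b) -ₚ b ≡ a
  [a+b]-b≡a a b = byℤ _ _ (⟦-⟧ (a +ₚ b) b (⟦+⟧ a b ≈-refl ≈-refl) ≈-refl) (eq ⟦ a ⟧ ⟦ b ⟧) ≈-refl
    where
    eq : ∀ x y → (x ℤ.+ y) ℤ.- y ≡ x
    eq = solve-∀

  [a-b]+b≡a : ∀ a b → (a -ₚ b) +ₚ b ≡ a
  [a-b]+b≡a a b = byℤ _ _ (⟦+⟧ (a -ₚ b) b (⟦-⟧ a b ≈-refl ≈-refl) ≈-refl) (eq ⟦ a ⟧ ⟦ b ⟧) ≈-refl
    where
    eq : ∀ x y → (x ℤ.- y) ℤ.+ y ≡ x
    eq = solve-∀

  [a+b]-c≡b+[a-c] : ∀ a b c → (a +ₚ b) -ₚ c ≡ b +ₚ (a -ₚ c)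
  [a+b]-c≡b+[a-c] a b c = byℤ _ _ (⟦-⟧ (a +ₚ b) c (⟦+⟧ a b ≈-refl ≈-refl) ≈-refl) (eq ⟦ a ⟧ ⟦ b ⟧ ⟦ c ⟧)
                                  (⟦+⟧ b (a -ₚ c) ≈-refl (⟦-⟧ a c ≈-refl ≈-refl))
    where
    eq : ∀ x y z → (x ℤ.+ y) ℤ.- z ≡ y ℤ.+ (x ℤ.- z)
    eq = solve-∀

  [c-c′]*b+[l-l′] : ∀ c c′ b l l′ → (c -ₚ c′) *ₚ b +ₚ (l -ₚ l′) ≡ (c *ₚ b +ₚ l) -ₚ (c′ *ₚ b +ₚ l′)
  [c-c′]*b+[l-l′] c c′ b l l′ = byℤ _ _
    (⟦+⟧ ((c -ₚ c′) *ₚ b) (l -ₚ l′) (⟦*⟧ (c -ₚ c′) b (⟦-⟧ c c′ ≈-refl ≈-refl) ≈-refl) (⟦-⟧ l l′ ≈-refl ≈-refl))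
    (eq ⟦ c ⟧ ⟦ c′ ⟧ ⟦ b ⟧ ⟦ l ⟧ ⟦ l′ ⟧)
    (⟦-⟧ (c *ₚ b +ₚ l) (c′ *ₚ b +ₚ l′) (⟦+⟧ (c *ₚ b) l (⟦*⟧ c b ≈-refl ≈-refl) ≈-refl) (⟦+⟧ (c′ *ₚ b) l′ (⟦*⟧ c′ b ≈-refl ≈-refl) ≈-refl))
    where
    eq : ∀ c c′ b l l′ → (c ℤ.- c′) ℤ.* b ℤ.+ (l ℤ.- l′) ≡ (c ℤ.* b ℤ.+ l) ℤ.- (c′ ℤ.* b ℤ.+ l′)
    eq = solve-∀

  a-b≡0⇒a≡b : ∀ a b → a -ₚ b ≡ 0p p → a ≡ b
  a-b≡0⇒a≡b a b a-b≡0 = begin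
    a                ≡⟨ [a-b]+b≡a a b ⟨
    (a -ₚ b) +ₚ b    ≡⟨ cong (_+ₚ b) a-b≡0 ⟩
    0p p +ₚ b        ≡⟨ +ₚ-comm (0p p) b ⟩
    b +ₚ 0p p        ≡⟨ +ₚ-identityʳ b ⟩
    b                ∎
    where open ≡-Reasoning

  infixl 6 _+ᵥ_ _-ᵥ_
  infixl 7 _·ᵥ_
  _+ᵥ_ _-ᵥ_ : ∀ {n} → Vn p n → Vn p n → Vn p n
  _+ᵥ_ = _+v_ p
  _-ᵥ_ = _-v_ p

  _·ᵥ_ : ∀ {n} → Fp p → Vn p n → Vn p n
  _·ᵥ_ = _·v_ p

  +ᵥ-comm : ∀ {n} (x y : Vn p n) → x +ᵥ y ≡ y +ᵥ x
  +ᵥ-comm []      []      = refl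
  +ᵥ-comm (a ∷ x) (b ∷ y) = cong₂ _∷_ (+ₚ-comm a b) (+ᵥ-comm x y)

  +ᵥ-assoc : ∀ {n} (x y z : Vn p n) → (x +ᵥ y) +ᵥ z ≡ x +ᵥ (y +ᵥ z)
  +ᵥ-assoc = Vecₚ.zipWith-assoc +ₚ-assoc

  +ᵥ-identityʳ : ∀ {n} (x : Vn p n) → x +ᵥ 0v p ≡ x
  +ᵥ-identityʳ = Vecₚ.zipWith-identityʳ +ₚ-identityʳ

  x-x≡0 : ∀ {n} (x : Vn p n) → x -ᵥ x ≡ 0v p
  x-x≡0 []      = refl
  x-x≡0 (a ∷ x) = cong₂ _∷_ (a-a≡0 a) (x-x≡0 x)

  x-y≡0⇒x≡y : ∀ {n} (x y : Vn p n) → x -ᵥ y ≡ 0v p → x ≡ y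
  x-y≡0⇒x≡y []      []      _     = refl
  x-y≡0⇒x≡y (a ∷ x) (b ∷ y) x-y≡0 =
    cong₂ _∷_ (a-b≡0⇒a≡b a b (Vecₚ.∷-injectiveˡ x-y≡0)) (x-y≡0⇒x≡y x y (Vecₚ.∷-injectiveʳ x-y≡0))

  [x+y]-y≡x : ∀ {n} (x y : Vn p n) → (x +ᵥ y) -ᵥ y ≡ x
  [x+y]-y≡x []      []      = refl
  [x+y]-y≡x (a ∷ x) (b ∷ y) = cong₂ _∷_ ([a+b]-b≡a a b) ([x+y]-y≡x x y)

  [x-y]+y≡x : ∀ {n} (x y : Vn p n) → (x -ᵥ y) +ᵥ y ≡ x
  [x-y]+y≡x []      []      = refl
  [x-y]+y≡x (a ∷ x) (b ∷ y) = cong₂ _∷_ ([a-b]+b≡a a b) ([x-y]+y≡x x y)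

  [x+y]-z≡y+[x-z] : ∀ {n} (x y z : Vn p n) → (x +ᵥ y) -ᵥ z ≡ y +ᵥ (x -ᵥ z)
  [x+y]-z≡y+[x-z] []      []      []      = refl
  [x+y]-z≡y+[x-z] (a ∷ x) (b ∷ y) (c ∷ z) = cong₂ _∷_ ([a+b]-c≡b+[a-c] a b c) ([x+y]-z≡y+[x-z] x y z)

  [c-c′]x+[y-y′] : ∀ {n} c c′ (x y y′ : Vn p n) → (c -ₚ c′) ·ᵥ x +ᵥ (y -ᵥ y′) ≡ (c ·ᵥ x +ᵥ y) -ᵥ (c′ ·ᵥ x +ᵥ y′)
  [c-c′]x+[y-y′] c c′ []      []      []        = refl
  [c-c′]x+[y-y′] c c′ (b ∷ x) (l ∷ y) (l′ ∷ y′) = cong₂ _∷_ ([c-c′]*b+[l-l′] c c′ b l l′) ([c-c′]x+[y-y′] c c′ x y y′)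

  lincomb-sub : ∀ {n k} (cs cs′ : Vn p k) (bs : Vec (Vn p n) k) →
    lincomb p (cs -ᵥ cs′) bs ≡ lincomb p cs bs -ᵥ lincomb p cs′ bs
  lincomb-sub []       []         []       = sym (x-x≡0 (0v p))
  lincomb-sub (c ∷ cs) (c′ ∷ cs′) (b ∷ bs) = trans (cong ((c -ₚ c′) ·ᵥ b +ᵥ_) (lincomb-sub cs cs′ bs))
    ([c-c′]x+[y-y′] c c′ b (lincomb p cs bs) (lincomb p cs′ bs))

  lincomb-injective : ∀ {n k} (bs : Vec (Vn p n) k) → LinIndep p bs →
    ∀ cs cs′ → lincomb p cs bs ≡ lincomb p cs′ bs → cs ≡ cs′
  lincomb-injective bs indep cs cs′ eq = x-y≡0⇒x≡y cs cs′ (indep (cs -ᵥ cs′) (begin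
    lincomb p (cs -ᵥ cs′) bs                 ≡⟨ lincomb-sub cs cs′ bs ⟩
    lincomb p cs bs -ᵥ lincomb p cs′ bs      ≡⟨ cong (_-ᵥ lincomb p cs′ bs) eq ⟩
    lincomb p cs′ bs -ᵥ lincomb p cs′ bs     ≡⟨ x-x≡0 (lincomb p cs′ bs) ⟩
    0v p                                     ∎))
    where open ≡-Reasoning

  _≟ᵥ_ : ∀ {n} → DecidableEquality (Vn p n)
  _≟ᵥ_ = Vecₚ.≡-dec Fin._≟_

  δ : ∀ {n} → Vn p n → Vn p n → ℚ
  δ x y = indQ (does (x ≟ᵥ y))

  indQ-∧ : ∀ u v → indQ (u ∧ v) ≡ indQ u * indQ v
  indQ-∧ true  v = sym (*-identityˡ (indQ v))
  indQ-∧ false v = sym (*-zeroˡ (indQ v))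

  sumQ-allFin-suc : ∀ m (f : Fin (suc m) → ℚ) → sumQ (allFin (suc m)) f ≡ f Fin.zero + sumQ (allFin m) (f ∘ Fin.suc)
  sumQ-allFin-suc m f = cong (_+_ (f Fin.zero))
    (trans (cong (λ l → sumQ l f) (sym (Listₚ.map-tabulate id Fin.suc))) (sumQ-map Fin.suc (allFin m) f))

  sumQ-allVn-suc : ∀ n (f : Vn p (suc n) → ℚ) → sumQ (allVn p (suc n)) f ≡ sumQ (allFin p) (λ a → sumQ (allVn p n) (λ x → f (a ∷ x)))
  sumQ-allVn-suc n f = trans (sumQ-concatMap (λ a → map (a ∷_) (allVn p n)) (allFin p) f)
    (sumQ-cong (allFin p) (λ a → sumQ-map (a ∷_) (allVn p n) f))

  sumQ-allFin-δ : ∀ m (a : Fin m) → sumQ (allFin m) (λ b → indQ (does (a Fin.≟ b))) ≡ 1ℚ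
  sumQ-allFin-δ (suc m) Fin.zero    = trans (sumQ-allFin-suc m (λ b → indQ (does (Fin.zero Fin.≟ b)))) (trans (cong (_+_ 1ℚ) (sumQ-zero (allFin m))) (+-identityʳ 1ℚ))
  sumQ-allFin-δ (suc m) (Fin.suc a) = trans (sumQ-allFin-suc m (λ b → indQ (does (Fin.suc a Fin.≟ b)))) (trans (+-identityˡ _) (sumQ-allFin-δ m a))

  sumQ-allVn-δ : ∀ n (x : Vn p n) → sumQ (allVn p n) (δ x) ≡ 1ℚ
  sumQ-allVn-δ zero    []      = +-identityʳ 1ℚ
  sumQ-allVn-δ (suc n) (a ∷ x) = begin
    sumQ (allVn p (suc n)) (δ (a ∷ x))
      ≡⟨ sumQ-allVn-suc n (δ (a ∷ x)) ⟩
    sumQ (allFin p) (λ b → sumQ (allVn p n) (λ y → indQ (does (a Fin.≟ b) ∧ does (x ≟ᵥ y))))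
      ≡⟨ sumQ-cong (allFin p) (λ b → trans (sumQ-cong (allVn p n) (λ y → indQ-∧ (does (a Fin.≟ b)) _)) (sumQ-*ˡ (indQ (does (a Fin.≟ b))) (allVn p n) (δ x))) ⟩
    sumQ (allFin p) (λ b → indQ (does (a Fin.≟ b)) * sumQ (allVn p n) (δ x))
      ≡⟨ sumQ-cong (allFin p) (λ b → trans (cong (indQ (does (a Fin.≟ b)) *_) (sumQ-allVn-δ n x)) (*-identityʳ _)) ⟩
    sumQ (allFin p) (λ b → indQ (does (a Fin.≟ b)))
      ≡⟨ sumQ-allFin-δ p a ⟩
    1ℚ ∎
    where open ≡-Reasoning

  sumQ-δ* : ∀ n (x : Vn p n) (f : Vn p n → ℚ) → sumQ (allVn p n) (λ y → δ x y * f y) ≡ f x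
  sumQ-δ* n x f = begin
    sumQ (allVn p n) (λ y → δ x y * f y)   ≡⟨ sumQ-cong (allVn p n) δ*f≡δ*fx ⟩
    sumQ (allVn p n) (λ y → δ x y * f x)   ≡⟨ sumQ-*ʳ (f x) (allVn p n) (δ x) ⟩
    sumQ (allVn p n) (δ x) * f x           ≡⟨ cong (_* f x) (sumQ-allVn-δ n x) ⟩
    1ℚ * f x                               ≡⟨ *-identityˡ (f x) ⟩
    f x                                    ∎
    where
    open ≡-Reasoning
    δ*f≡δ*fx : ∀ y → δ x y * f y ≡ δ x y * f x
    δ*f≡δ*fx y with x ≟ᵥ y
    ... | yes refl = refl
    ... | no  _    = trans (*-zeroˡ (f y)) (sym (*-zeroˡ (f x)))

  sumQ-bijection : ∀ n (σ τ : Vn p n → Vn p n) → (∀ x → τ (σ x) ≡ x) → (∀ y → σ (τ y) ≡ y) →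
    ∀ f → sumQ (allVn p n) (f ∘ σ) ≡ sumQ (allVn p n) f
  sumQ-bijection n σ τ τσ≡id στ≡id f = begin
    sumQ V (f ∘ σ)                             ≡⟨ sumQ-cong V {λ x → sumQ V (λ y → δ (σ x) y * f y)} (λ x → sumQ-δ* n (σ x) f) ⟨
    sumQ V (λ x → sumQ V (λ y → δ (σ x) y * f y)) ≡⟨ sumQ-swap V V _ ⟩
    sumQ V (λ y → sumQ V (λ x → δ (σ x) y * f y)) ≡⟨ sumQ-cong V (λ y → sumQ-cong V (λ x → cong (λ b → indQ b * f y) (σx≡y⇔τy≡x x y))) ⟩
    sumQ V (λ y → sumQ V (λ x → δ (τ y) x * f y)) ≡⟨ sumQ-cong V (λ y → trans (sumQ-*ʳ (f y) V (δ (τ y))) (cong (_* f y) (sumQ-allVn-δ n (τ y)))) ⟩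
    sumQ V (λ y → 1ℚ * f y)                    ≡⟨ sumQ-cong V (λ y → *-identityˡ (f y)) ⟩
    sumQ V f                                   ∎
    where
    open ≡-Reasoning
    V = allVn p n
    σx≡y⇔τy≡x : ∀ x y → does (σ x ≟ᵥ y) ≡ does (τ y ≟ᵥ x)
    σx≡y⇔τy≡x x y = does-⇔ (mk⇔ (λ σx≡y → trans (cong τ (sym σx≡y)) (τσ≡id x)) (λ τy≡x → trans (cong σ (sym τy≡x)) (στ≡id y)))
                           (σ x ≟ᵥ y) (τ y ≟ᵥ x)

  sumQ-allVn-translate : ∀ n (f : Vn p n → ℚ) h → sumQ (allVn p n) (λ x → f (x +ᵥ h)) ≡ sumQ (allVn p n) f
  sumQ-allVn-translate n f h = sumQ-bijection n (_+ᵥ h) (_-ᵥ h) (λ x → [x+y]-y≡x x h) (λ y → [x-y]+y≡x y h) f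

  length-allVn : ∀ n → length (allVn p n) ≡ p ^ n
  length-allVn zero    = refl
  length-allVn (suc n) = trans (length-concatMap-map _∷_ (allFin p) (allVn p n))
    (cong₂ ℕ._*_ (Listₚ.length-tabulate {n = p} id) (length-allVn n))

  allVn≢[] : ∀ n → allVn p n ≢ []
  allVn≢[] n allVn≡[] = ℕ.≢-nonZero⁻¹ (p ^ n) {{ℕₚ.m^n≢0 p n}} (trans (sym (length-allVn n)) (cong length allVn≡[]))

  -- Each vector of a subspace is the image of exactly one coefficient vector.
  indQ-subspace : ∀ {n k} (W : Vn p n → Bool) ((bs , indep , W⇔span) : IsSubspaceOfDim p W k) y →
    indQ (W y) ≡ sumQ (allVn p k) (λ cs → δ (lincomb p cs bs) y)
  indQ-subspace {k = k} W (bs , indep , W⇔span) y with W y in Wy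
  ... | true  = sym (one-preimage (proj₁ (Equivalence.to (W⇔span y) Wy)) (proj₂ (Equivalence.to (W⇔span y) Wy)))
    where
    one-preimage : ∀ cs₀ → lincomb p cs₀ bs ≡ y → sumQ (allVn p k) (λ cs → δ (lincomb p cs bs) y) ≡ 1ℚ
    one-preimage cs₀ cs₀↦y = trans (sumQ-cong (allVn p k) (λ cs → cong indQ (does-⇔ (↦y⇔≡cs₀ cs) (lincomb p cs bs ≟ᵥ y) (cs₀ ≟ᵥ cs)))) (sumQ-allVn-δ k cs₀)
      where
      ↦y⇔≡cs₀ : ∀ cs → (lincomb p cs bs ≡ y) ⇔ (cs₀ ≡ cs)
      ↦y⇔≡cs₀ cs = mk⇔ (λ cs↦y → lincomb-injective bs indep cs₀ cs (trans cs₀↦y (sym cs↦y)))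
                       (λ cs₀≡cs → trans (cong (λ c → lincomb p c bs) (sym cs₀≡cs)) cs₀↦y)
  ... | false = sym (trans (sumQ-cong (allVn p k) (λ cs → cong indQ (dec-false (lincomb p cs bs ≟ᵥ y) (not-in-span cs))))
                           (sumQ-zero (allVn p k)))
    where
    not-in-span : ∀ cs → lincomb p cs bs ≢ y
    not-in-span cs cs↦y with () ← trans (sym Wy) (Equivalence.from (W⇔span y) (cs , cs↦y))

  sumQ-subspace : ∀ {n k} (W : Vn p n → Bool) → IsSubspaceOfDim p W k → sumQ (allVn p n) (indQ ∘ W) ≡ fromℕ (p ^ k)
  sumQ-subspace {n} {k} W W-dim@(bs , _) = begin
    sumQ (allVn p n) (indQ ∘ W)                                            ≡⟨ sumQ-cong (allVn p n) (indQ-subspace W W-dim) ⟩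
    sumQ (allVn p n) (λ y → sumQ (allVn p k) (λ cs → δ (lincomb p cs bs) y)) ≡⟨ sumQ-swap (allVn p n) (allVn p k) _ ⟩
    sumQ (allVn p k) (λ cs → sumQ (allVn p n) (δ (lincomb p cs bs)))        ≡⟨ sumQ-cong (allVn p k) (λ cs → sumQ-allVn-δ n (lincomb p cs bs)) ⟩
    sumQ (allVn p k) (λ _ → 1ℚ)                                            ≡⟨ sumQ-const (allVn p k) 1ℚ ⟩
    fromℕ (length (allVn p k)) * 1ℚ                                        ≡⟨ *-identityʳ _ ⟩
    fromℕ (length (allVn p k))                                             ≡⟨ cong fromℕ (length-allVn k) ⟩
    fromℕ (p ^ k)                                                          ∎
    where open ≡-Reasoning

  rho≡invℕ : ∀ d → rho p d ≡ invℕ (p ^ d)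
  rho≡invℕ d = sym (invℕ≡1/ (p ^ d) {{ℕₚ.m^n≢0 p d}})

  avg-subspace : ∀ {n d} (W : Vn p n → Bool) → IsSubspaceOfCodim p W d → avg (allVn p n) (indQ ∘ W) ≡ rho p d
  avg-subspace {n} {d} W (d≤n , W-dim) = begin
    avg (allVn p n) (indQ ∘ W)                           ≡⟨ avg≡sumQ*invℕ (allVn p n) _ ⟩
    sumQ (allVn p n) (indQ ∘ W) * invℕ (length (allVn p n)) ≡⟨ cong₂ _*_ (sumQ-subspace W W-dim) (cong invℕ (trans (length-allVn n) p^n≡p^k*p^d)) ⟩
    fromℕ (p ^ k) * invℕ (p ^ k ℕ.* p ^ d)               ≡⟨ cong (fromℕ (p ^ k) *_) (invℕ-* (p ^ k) (p ^ d)) ⟩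
    fromℕ (p ^ k) * (invℕ (p ^ k) * invℕ (p ^ d))        ≡⟨ *-assoc (fromℕ (p ^ k)) _ _ ⟨
    fromℕ (p ^ k) * invℕ (p ^ k) * invℕ (p ^ d)          ≡⟨ cong (_* invℕ (p ^ d)) (fromℕ*invℕ (p ^ k) {{ℕₚ.m^n≢0 p k}}) ⟩
    1ℚ * invℕ (p ^ d)                                    ≡⟨ *-identityˡ _ ⟩
    invℕ (p ^ d)                                         ≡⟨ rho≡invℕ d ⟨
    rho p d                                              ∎
    where
    open ≡-Reasoning
    k = n ℕ.∸ d
    p^n≡p^k*p^d : p ^ n ≡ p ^ k ℕ.* p ^ d
    p^n≡p^k*p^d = trans (cong (p ^_) (sym (ℕₚ.m∸n+n≡m d≤n))) (ℕₚ.^-distribˡ-+-* p k d)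

-- The fibre average of Φ − αρ

vecGroup-abelianLaws : ∀ p .{{_ : NonZero p}} n → AbelianLaws (VecGroup p n)
vecGroup-abelianLaws p n = record
  { ⊕-comm = +ᵥ-comm ; ⊕-assoc = +ᵥ-assoc ; sumQ-translate = sumQ-allVn-translate n }
  where open FpArithmetic p

pairGroup-abelianLaws : ∀ p .{{_ : NonZero p}} n → AbelianLaws (PairGroup p n)
pairGroup-abelianLaws p n = ×-abelianLaws (vecGroup-abelianLaws p n) (vecGroup-abelianLaws p n)

powQ-p^d*powQ-rho : ∀ p .{{_ : NonZero p}} d k → powQ (fromℕ (p ^ d)) k * powQ (rho p d) k ≡ 1ℚ
powQ-p^d*powQ-rho p d k = begin
  powQ (fromℕ (p ^ d)) k * powQ (rho p d) k  ≡⟨ powQ-*-distrib (fromℕ (p ^ d)) (rho p d) k ⟨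
  powQ (fromℕ (p ^ d) * rho p d) k           ≡⟨ cong (λ r → powQ (fromℕ (p ^ d) * r) k) (FpArithmetic.rho≡invℕ p d) ⟩
  powQ (fromℕ (p ^ d) * invℕ (p ^ d)) k      ≡⟨ cong (λ r → powQ r k) (fromℕ*invℕ (p ^ d) {{ℕₚ.m^n≢0 p d}}) ⟩
  powQ 1ℚ k                                  ≡⟨ powQ-one k ⟩
  1ℚ                                         ∎
  where open ≡-Reasoning

module FibreAverage (p : ℕ) .{{_ : NonZero p}} {n d : ℕ} (A : Vn p n → Bool) (u : Vn p n)
                    (V : Vn p n → Vn p n → Bool) (V-codim : ∀ x → IsSubspaceOfCodim p (V x) d) where

  open FpArithmetic p
  open GowersInnerProduct (VecGroup p n) (vecGroup-abelianLaws p n) using (𝔼-translate)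
  open GowersInnerProduct (PairGroup p n) (pairGroup-abelianLaws p n) using (average; gowersPow-cong)

  α ρ : ℚ
  α = density p A
  ρ = rho p d

  A-α : Vn p n → ℚ
  A-α x = indQ (A x) - α

  Φ-αρ : Vn p n × Vn p n → ℚ
  Φ-αρ z = indQ (Phi p A u V z) - α * ρ

  fibre : List (Vn p n × Vn p n)
  fibre = map (0v p ,_) (allVn p n)

  fibre≢[] : fibre ≢ []
  fibre≢[] = map≢[] (0v p ,_) (allVn≢[] n)

  avg-Φ-fibre : ∀ x y → avg (allVn p n) (λ t → indQ (Phi p A u V (x , y +ᵥ t))) ≡ ρ * indQ (A x)
  avg-Φ-fibre x y with A x
  ... | true  = begin
    avg (allVn p n) (λ t → indQ (V x ((y +ᵥ t) -ᵥ u)))  ≡⟨ avg-cong (allVn p n) (λ t → cong (indQ ∘ V x) ([x+y]-z≡y+[x-z] y t u)) ⟩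
    avg (allVn p n) (λ t → indQ (V x (t +ᵥ (y -ᵥ u))))  ≡⟨ 𝔼-translate (indQ ∘ V x) (y -ᵥ u) ⟩
    avg (allVn p n) (indQ ∘ V x)                       ≡⟨ avg-subspace (V x) (V-codim x) ⟩
    ρ                                                  ≡⟨ *-identityʳ ρ ⟨
    ρ * 1ℚ                                             ∎
    where open ≡-Reasoning
  ... | false = trans (avg-const (allVn≢[] n) 0ℚ) (sym (*-zeroʳ ρ))

  average-Φ-αρ : ∀ z → average Φ-αρ fibre fibre≢[] z ≡ ρ * A-α (proj₁ z)
  average-Φ-αρ (x , y) = begin
    avg fibre (λ t → Φ-αρ (x +ᵥ proj₁ t , y +ᵥ proj₂ t))
      ≡⟨ avg-map (0v p ,_) (allVn p n) _ ⟩
    avg (allVn p n) (λ t → Φ-αρ (x +ᵥ 0v p , y +ᵥ t))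
      ≡⟨ avg-cong (allVn p n) (λ t → cong (λ x′ → Φ-αρ (x′ , y +ᵥ t)) (+ᵥ-identityʳ x)) ⟩
    avg (allVn p n) (λ t → indQ (Phi p A u V (x , y +ᵥ t)) + - (α * ρ))
      ≡⟨ avg-+ (allVn p n) _ _ ⟩
    avg (allVn p n) (λ t → indQ (Phi p A u V (x , y +ᵥ t))) + avg (allVn p n) (λ _ → - (α * ρ))
      ≡⟨ cong₂ _+_ (avg-Φ-fibre x y) (avg-const (allVn≢[] n) _) ⟩
    ρ * indQ (A x) + - (α * ρ)
      ≡⟨ solve 3 (λ r i a → r :* i :+ (:- (a :* r)) := r :* (i :- a)) refl ρ (indQ (A x)) α ⟩
    ρ * A-α x ∎
    where
    open ≡-Reasoning
    open +-*-Solver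

  gowersPow-average-Φ-αρ : ∀ s → gowersPow (PairGroup p n) s (average Φ-αρ fibre fibre≢[])
                                 ≡ powQ ρ (2 ^ s) * gowersPow (VecGroup p n) s A-α
  gowersPow-average-Φ-αρ s = begin
    gowersPow (PairGroup p n) s (average Φ-αρ fibre fibre≢[])  ≡⟨ gowersPow-cong s average-Φ-αρ ⟩
    gowersPow (PairGroup p n) s (λ z → ρ * A-α (proj₁ z))      ≡⟨ gowersPow-* (PairGroup p n) s ρ (A-α ∘ proj₁) ⟩
    powQ ρ (2 ^ s) * gowersPow (PairGroup p n) s (A-α ∘ proj₁) ≡⟨ cong (powQ ρ (2 ^ s) *_) (gowersPow-∘proj₁ (VecGroup p n) (VecGroup p n) (allVn≢[] n) s A-α) ⟩
    powQ ρ (2 ^ s) * gowersPow (VecGroup p n) s A-α            ∎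
    where open ≡-Reasoning

lemma4p2 : (p : ℕ) .{{_ : NonZero p}} → Prime p → (n d s : ℕ)
    → (A : Vn p n → Bool) (u : Vn p n) (V : Vn p n → Vn p n → Bool)
    → (∀ x → IsSubspaceOfCodim p (V x) d)
    → gowersPow (VecGroup p n) s (λ x → indQ (A x) - density p A)
      ≤ powQ ((+ (p ^ d)) / 1) (2 ^ s)
        * gowersPow (PairGroup p n) s
            (λ z → indQ (Phi p A u V z) - density p A * rho p d)
lemma4p2 p _ n d s A u V V-codim = begin
  gowersPow (VecGroup p n) s A-α                       ≡⟨ *-identityˡ _ ⟨
  1ℚ * gowersPow (VecGroup p n) s A-α                  ≡⟨ cong (_* gowersPow (VecGroup p n) s A-α) (powQ-p^d*powQ-rho p d (2 ^ s)) ⟨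
  P * powQ ρ (2 ^ s) * gowersPow (VecGroup p n) s A-α  ≡⟨ *-assoc P (powQ ρ (2 ^ s)) _ ⟩
  P * (powQ ρ (2 ^ s) * gowersPow (VecGroup p n) s A-α) ≡⟨ cong (P *_) (gowersPow-average-Φ-αρ s) ⟨
  P * gowersPow (PairGroup p n) s (average Φ-αρ fibre fibre≢[])
                                                       ≤⟨ *-monoˡ-≤-nonNeg P {{nonNegative 0≤P}} (gowersPow-average≤ Φ-αρ fibre fibre≢[] s) ⟩
  P * gowersPow (PairGroup p n) s Φ-αρ                 ∎
  where
  open ≤-Reasoning
  open FibreAverage p A u V V-codim
  open GowersInnerProduct (PairGroup p n) (pairGroup-abelianLaws p n) using (average; gowersPow-average≤)
  P = powQ (fromℕ (p ^ d)) (2 ^ s)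
  0≤P : 0ℚ ≤ P
  0≤P = powQ-nonNeg _ (2 ^ s) (fromℕ-nonNeg (p ^ d))
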